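{- Let $A$ be a non-empty array and $n\in\mathbb{N}$, and let $G,B_0,B_1,\dots,B_n,m_0$ be as in the definition of the expansion $A[n]$ (see context), with $l_0,l_1$ the lengths of $G$ and $B_0$. Ancestry relations "in $A[n]$" refer to the columns of $A[n]=G+B_0+\dots+B_n$, and "in $A$" to the columns of $A=G+B_0+(C)$. Then: (i) For all $i<l_0$, $j<l_1$ and $k\in\mathbb{N}$: in $A[n]$, the $i$-th column of $G$ is a $k$-ancestor of the $j$-th column of $B_0$ iff it is a $k$-ancestor of the $j$-th column of $B_n$. (ii) For all $i,j<l_1$ and $k\in\mathbb{N}$: in $A[n]$, the $i$-th column of $B_0$ is a $k$-ancestor of the $j$-th column of $B_0$ iff the $i$-th column of $B_n$ is a $k$-ancestor of the $j$-th column of $B_n$. (iii) If $n>0$, then for all $i<l_1$ and $k<m_0$: in $A$, the $i$-th column of $B_0$ is a $k$-ancestor of the last column $C$ of $A$ iff, in $A[n]$, the $i$-th column of $B_{n-1}$ is a $k$-ancestor of the first column of $B_n$. (iv) For all $0<i<l_1$ and $k\in\mathbb{N}$: in $A[n]$, the $k$-parent of the $i$-th column of $B_n$ (if it exists) lies either in $B_n$ or in $G$. (v) For all $i,j<l_1$, $k\in\mathbb{N}$ and $n_0<n_1<n$: in $A[n]$, the $i$-th column of $B_{n_0}$ is a $k$-ancestor of the $j$-th column of $B_{n_1}$ iff it is a $k$-ancestor of the $j$-th column of $B_{n_1+1}$.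
   Context: An array is a finite sequence of equal-length finite sequences of natural numbers, i.e. an element of $(\mathbb{N}^n)^m$ for some $n,m\in\mathbb{N}$; its elements are called its columns, indexed from $0$, and entries of a column are indexed from $0$ (the $m$-th entry of a column lies in "row $m$"). Concatenation of sequences is denoted $+$. Ancestry: let $A$ be an array. For a natural number $m$ and a column $D$ of $A$, the $m$-parent of $D$ is the last column of $A$ before $D$ whose $m$-th entry is smaller than the $m$-th entry of $D$ and which, if $m>0$, is an $(m-1)$-ancestor of $D$; if no such column exists (in particular if $m$ is at least the column length), $D$ has no $m$-parent. The (strict) $m$-ancestors of $D$ are its $m$-parent and the $m$-ancestors of its $m$-parent. Expansion: for a non-empty array $A$ and $n\in\mathbb{N}$, let $C$ be the last column of $A$, and let $m_0$ be the largest $m$ such that $C$ has an $m$-parent (undefined if there is none). Write $A=G+B_0+(C)$, where $B_0$ begins with the $m_0$-parent of $C$ if $m_0$ is defined, and $B_0$ is empty otherwise. For a column $D$ in $B_0$ and $m<m_0$, the $m$-th entry of $D$ is said to ascend if the first column of $B_0$ is $D$ or is an $m$-ancestor of $D$ (in $A$). For $i\ge 1$, $B_i$ is a copy of $B_0$ in which each ascending entry, lying in row $m$, is increased by $i\cdot(c_m-r_m)$, where $c_m$ is the $m$-th entry of $C$ and $r_m$ is the $m$-th entry of the first column of $B_0$. Then $A[n]=G+B_0+B_1+\dots+B_n$, with all rows at the bottom that consist entirely of zeros removed. -}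

module Defs where

open import Data.Nat using (ℕ; zero; suc; _+_; _*_; _∸_; _<_; _<ᵇ_; _≡ᵇ_)
open import Data.Bool using (Bool; true; false; if_then_else_; _∧_)
open import Data.List using (List; []; _∷_; _++_; length; take; drop; map; concat; applyUpTo)
open import Data.List.Relation.Unary.All using (All)
open import Data.Maybe using (Maybe; just; nothing)
open import Data.Product using (_×_; ∃)
open import Data.Sum using (_⊎_)
open import Data.Unit using (⊤)
open import Relation.Nullary using (¬_)
open import Relation.Binary.PropositionalEquality using (_≡_)
open import Relation.Binary.Construct.Closure.Transitive using (TransClosure)
open import Function.Bundles using (_⇔_)

-- Arrays: a list of columns, each column a list of naturals
-- (entry m of a column lies in row m).  Columns are indexed from 0.

Column : Set
Column = List ℕ

Array : Set
Array = List Column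

IsArray : Array → Set
IsArray A = ∃ λ h → All (λ D → length D ≡ h) A

nth : {X : Set} → X → List X → ℕ → X
nth d []       _       = d
nth d (x ∷ xs) zero    = x
nth d (x ∷ xs) (suc n) = nth d xs n

col : Array → ℕ → Column
col A d = nth [] A d

ent : Array → ℕ → ℕ → ℕ
ent A d m = nth 0 (col A d) m

lastIdx : Array → ℕ
lastIdx A = length A ∸ 1

mutual
  Cand : Array → ℕ → ℕ → ℕ → Set
  Cand A m q d = q < d × d < length A × m < length (col A d)
                 × ent A q m < ent A d m × Prev A m q d

  Prev : Array → ℕ → ℕ → ℕ → Set
  Prev A zero    q d = ⊤
  Prev A (suc m) q d = Anc A m q d

  Par : Array → ℕ → ℕ → ℕ → Set
  Par A m p d = Cand A m p d × (∀ q → p < q → q < d → ¬ Cand A m q d)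

  Anc : Array → ℕ → ℕ → ℕ → Set
  Anc A m p d = TransClosure (Par A m) p d

HasParent : Array → ℕ → ℕ → Set
HasParent A m d = ∃ λ p → Par A m p d

-- Data of the expansion, specified relationally.
-- M0 A mm : mm = just m0 where m0 is the largest m such that the last
-- column C has an m-parent; mm = nothing if C has no parent at all.

M0 : Array → Maybe ℕ → Set
M0 A (just m0) = HasParent A m0 (lastIdx A) × (∀ m → m0 < m → ¬ HasParent A m (lastIdx A))
M0 A nothing   = ∀ m → ¬ HasParent A m (lastIdx A)

-- Split A mm l0 : l0 (= length of G) is the index of the first column of B0,
-- i.e. of the m0-parent of C; if m0 is undefined, B0 is empty.
Split : Array → Maybe ℕ → ℕ → Set
Split A (just m0) l0 = Par A m0 l0 (lastIdx A)
Split A nothing   l0 = l0 ≡ lastIdx A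

len1 : Array → ℕ → ℕ
len1 A l0 = lastIdx A ∸ l0

G : Array → ℕ → Array
G A l0 = take l0 A

B0 : Array → ℕ → Array
B0 A l0 = take (len1 A l0) (drop l0 A)

-- asc j m = true iff the m-th entry of the j-th column of B0 ascends
-- (only consulted for j < l1 and m < m0).
AscSpec : Array → Maybe ℕ → ℕ → (ℕ → ℕ → Bool) → Set
AscSpec A mm l0 asc = ∀ m0 → mm ≡ just m0 → ∀ j m → j < len1 A l0 → m < m0 →
  (asc j m ≡ true) ⇔ ((j ≡ 0) ⊎ Anc A m l0 (l0 + j))

below : Maybe ℕ → ℕ → Bool
below nothing   m = false
below (just m0) m = m <ᵇ m0

bumpFrom : (ℕ → Bool) → (ℕ → ℕ) → ℕ → Column → Column
bumpFrom up δ m []       = []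
bumpFrom up δ m (x ∷ xs) = (if up m then x + δ m else x) ∷ bumpFrom up δ (suc m) xs

-- B_i : copy of B0 whose ascending entries in row m are increased by
-- i * (c_m - r_m)
blockFrom : Array → Maybe ℕ → ℕ → (ℕ → ℕ → Bool) → ℕ → ℕ → Array → Array
blockFrom A mm l0 asc i j []       = []
blockFrom A mm l0 asc i j (D ∷ Ds) =
  bumpFrom (λ m → below mm m ∧ asc j m)
           (λ m → i * (ent A (lastIdx A) m ∸ ent A l0 m)) 0 D
  ∷ blockFrom A mm l0 asc i (suc j) Ds

Bi : Array → Maybe ℕ → ℕ → (ℕ → ℕ → Bool) → ℕ → Array
Bi A mm l0 asc i = blockFrom A mm l0 asc i 0 (B0 A l0)

lastIsZero : Column → Bool
lastIsZero []           = false
lastIsZero (x ∷ [])     = x ≡ᵇ 0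
lastIsZero (x ∷ y ∷ xs) = lastIsZero (y ∷ xs)

dropLast : Column → Column
dropLast []           = []
dropLast (x ∷ [])     = []
dropLast (x ∷ y ∷ xs) = x ∷ dropLast (y ∷ xs)

height : Array → ℕ
height []      = 0
height (D ∷ _) = length D

allB : (Column → Bool) → Array → Bool
allB p []       = true
allB p (D ∷ Ds) = p D ∧ allB p Ds

trim : ℕ → Array → Array
trim zero    A = A
trim (suc f) A = if allB lastIsZero A then trim f (map dropLast A) else A

removeZeroRows : Array → Array
removeZeroRows A = trim (height A) A

expand : Array → ℕ → Maybe ℕ → ℕ → (ℕ → ℕ → Bool) → Array
expand A n mm l0 asc =
  removeZeroRows (G A l0 ++ B0 A l0 ++ concat (applyUpTo (λ t → Bi A mm l0 asc (suc t)) n))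

pos : ℕ → ℕ → ℕ → ℕ → ℕ
pos l0 l1 t j = l0 + t * l1 + j

-- The copies B_t differ from B0 only by the shift t·(c_m − r_m) of the
-- ascending entries, and below row m0 the first column of B_(t+1) stands to
-- B_t as C stands to B0.  Hence comparisons of entries within a copy, between
-- a copy and G, and between B_t and the first column of B_(t+1) come out as
-- in A.  By induction on the row k (k-parents are defined through
-- (k−1)-ancestry) every k-parent in A[n] of a column of B_t is the copy of the
-- corresponding k-parent in A, except that for k < m0 the first column of
-- B_(t+1) gets the copy in B_t of the k-parent of C.  So the k-ancestors of a
-- column of B_t are copies of k-ancestors in A lying in G, in B_t, or, through
-- the first columns of the later copies, in an earlier B_s; (i)–(v) are read
-- off from this description.

module Submission where

open import Defs
open import Data.Nat
  using (ℕ; zero; suc; _+_; _*_; _∸_; _<_; _≮_; _≤_; z≤n; s≤s; z<s; _<ᵇ_; _<?_; _≤?_; _≟_;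
         NonZero; >-nonZero)
open import Data.Nat.Properties
open import Data.Nat.DivMod using (_/_; _%_; m≡m%n+[m/n]*n; m%n<n)
open import Data.Nat.Induction using (<-wellFounded)
open import Induction.WellFounded using (Acc; acc)
open import Data.Bool using (Bool; true; false; T; _∧_; if_then_else_)
open import Data.Bool.Properties using (T-≡)
open import Data.List using (List; []; _∷_; _++_; length; take; drop; map; concat; applyUpTo)
open import Data.List.Properties using (length-++; length-map; length-take; length-drop)
open import Data.List.Relation.Unary.All using (All; _∷_)
open import Data.Maybe using (Maybe; just; nothing)
open import Data.Product as Product using (_×_; _,_; proj₁; proj₂; ∃; ∃₂)
open import Data.Sum as Sum using (_⊎_; inj₁; inj₂)
open import Data.Unit using (⊤; tt)
open import Data.Empty using (⊥; ⊥-elim)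
open import Function.Base using (_∘_)
open import Function.Bundles using (_⇔_; mk⇔; Equivalence)
import Function.Properties.Equivalence as ⇔
open import Relation.Nullary using (¬_; Dec; yes; no)
open import Relation.Binary.Definitions using (tri<; tri≈; tri>)
open import Relation.Binary.PropositionalEquality
  using (_≡_; _≢_; refl; sym; trans; cong; cong₂; subst; subst₂; module ≡-Reasoning)
open import Relation.Binary.Construct.Closure.Transitive
  using (TransClosure; [_]; _∷_; _∷ʳ_) renaming (_++_ to _++⁺_)

lastSatisfying : (Q : ℕ → Set) → (∀ q → Dec (Q q)) → ∀ y →
  (∃ λ p → p < y × Q p × (∀ q → p < q → q < y → ¬ Q q)) ⊎ (∀ q → q < y → ¬ Q q)
lastSatisfying Q Q? zero = inj₂ (λ q ())
lastSatisfying Q Q? (suc y) with Q? y | lastSatisfying Q Q? y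
... | yes Qy | _ = inj₁ (y , ≤-refl , Qy , λ q y<q q<1+y _ → <⇒≱ y<q (<⇒≤pred q<1+y))
... | no ¬Qy | inj₁ (p , p<y , Qp , after) = inj₁ (p , m<n⇒m<1+n p<y , Qp , after′)
  where
  after′ : ∀ q → p < q → q < suc y → ¬ Q q
  after′ q p<q q<1+y with m<1+n⇒m<n∨m≡n q<1+y
  ... | inj₁ q<y  = after q p<q q<y
  ... | inj₂ refl = ¬Qy
... | no ¬Qy | inj₂ none = inj₂ none′
  where
  none′ : ∀ q → q < suc y → ¬ Q q
  none′ q q<1+y with m<1+n⇒m<n∨m≡n q<1+y
  ... | inj₁ q<y  = none q q<y
  ... | inj₂ refl = ¬Qy

-- Cand's conjunct m < length (col A d) is
-- dropped: it follows from the comparison of entries, entries outside a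
-- column being 0.
module Ancestry (e : ℕ → ℕ → ℕ) (L : ℕ) where

  mutual
    Candidate : ℕ → ℕ → ℕ → Set
    Candidate m q d = q < d × d < L × e q m < e d m × Prior m q d

    Prior : ℕ → ℕ → ℕ → Set
    Prior zero    q d = ⊤
    Prior (suc m) q d = Ancestor m q d

    Parent : ℕ → ℕ → ℕ → Set
    Parent m p d = Candidate m p d × (∀ q → p < q → q < d → ¬ Candidate m q d)

    Ancestor : ℕ → ℕ → ℕ → Set
    Ancestor m = TransClosure (Parent m)

  AncestorOrSelf : ℕ → ℕ → ℕ → Set
  AncestorOrSelf m q p = q ≡ p ⊎ Ancestor m q p

  Parent⇒< : ∀ {m p d} → Parent m p d → p < d
  Parent⇒< ((p<d , _) , _) = p<d

  Parent⇒bound : ∀ {m p d} → Parent m p d → d < L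
  Parent⇒bound ((_ , d<L , _) , _) = d<L

  Parent⇒entry< : ∀ {m p d} → Parent m p d → e p m < e d m
  Parent⇒entry< ((_ , _ , lt , _) , _) = lt

  Parent⇒Prior : ∀ {m p d} → Parent m p d → Prior m p d
  Parent⇒Prior ((_ , _ , _ , pr) , _) = pr

  Ancestor⇒< : ∀ {m p d} → Ancestor m p d → p < d
  Ancestor⇒< [ x ]    = Parent⇒< x
  Ancestor⇒< (x ∷ xs) = <-trans (Parent⇒< x) (Ancestor⇒< xs)

  Ancestor⇒bound : ∀ {m p d} → Ancestor m p d → d < L
  Ancestor⇒bound [ x ]    = Parent⇒bound x
  Ancestor⇒bound (_ ∷ xs) = Ancestor⇒bound xs

  Ancestor⇒entry< : ∀ {m p d} → Ancestor m p d → e p m < e d m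
  Ancestor⇒entry< [ x ]    = Parent⇒entry< x
  Ancestor⇒entry< (x ∷ xs) = <-trans (Parent⇒entry< x) (Ancestor⇒entry< xs)

  AncestorOrSelf⇒≤ : ∀ {m q p} → AncestorOrSelf m q p → q ≤ p
  AncestorOrSelf⇒≤ (inj₁ refl) = ≤-refl
  AncestorOrSelf⇒≤ (inj₂ a)    = <⇒≤ (Ancestor⇒< a)

  Parent-unique : ∀ {m p p′ d} → Parent m p d → Parent m p′ d → p ≡ p′
  Parent-unique {p = p} {p′} P P′ with <-cmp p p′
  ... | tri< p<p′ _ _ = ⊥-elim (proj₂ P p′ p<p′ (Parent⇒< P′) (proj₁ P′))
  ... | tri≈ _ p≡p′ _ = p≡p′
  ... | tri> _ _ p′<p = ⊥-elim (proj₂ P′ p p′<p (Parent⇒< P) (proj₁ P))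

  Ancestor⇒Parent : ∀ {m q d} → Ancestor m q d → ∃ λ p → Parent m p d × AncestorOrSelf m q p
  Ancestor⇒Parent [ x ] = _ , x , inj₁ refl
  Ancestor⇒Parent (x ∷ xs) with Ancestor⇒Parent xs
  ... | p , P , inj₁ refl = p , P , inj₂ [ x ]
  ... | p , P , inj₂ a    = p , P , inj₂ (x ∷ a)

  Candidate≤Parent : ∀ {m q p d} → Candidate m q d → Parent m p d → q ≤ p
  Candidate≤Parent {q = q} {p} c P with <-cmp q p
  ... | tri< q<p _ _ = <⇒≤ q<p
  ... | tri≈ _ q≡p _ = ≤-reflexive q≡p
  ... | tri> _ _ p<q = ⊥-elim (proj₂ P q p<q (proj₁ c) c)

  Ancestor≤Parent : ∀ {m q p d} → Ancestor m q d → Parent m p d → q ≤ p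
  Ancestor≤Parent a P with Ancestor⇒Parent a
  ... | p′ , P′ , q≤p′ rewrite Parent-unique P′ P = AncestorOrSelf⇒≤ q≤p′

  Ancestor-suc⇒Ancestor : ∀ {m p d} → Ancestor (suc m) p d → Ancestor m p d
  Ancestor-suc⇒Ancestor [ x ]    = Parent⇒Prior x
  Ancestor-suc⇒Ancestor (x ∷ xs) = Parent⇒Prior x ++⁺ Ancestor-suc⇒Ancestor xs

  Ancestor-antimono : ∀ {m m′ p d} → m′ ≤ m → Ancestor m p d → Ancestor m′ p d
  Ancestor-antimono {zero}  z≤n a = a
  Ancestor-antimono {suc m} m′≤ a with m≤n⇒m<n∨m≡n m′≤
  ... | inj₂ refl = a
  ... | inj₁ m′<  = Ancestor-antimono {m} (<⇒≤pred m′<) (Ancestor-suc⇒Ancestor a)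

  Ancestor⇒Prior : ∀ {m p d} → Ancestor m p d → Prior m p d
  Ancestor⇒Prior {zero}  _ = tt
  Ancestor⇒Prior {suc m} a = Ancestor-suc⇒Ancestor a

  Ancestor⇒Candidate : ∀ {m p d} → Ancestor m p d → Candidate m p d
  Ancestor⇒Candidate a = Ancestor⇒< a , Ancestor⇒bound a , Ancestor⇒entry< a , Ancestor⇒Prior a

  Ancestor-chain : ∀ {m p q d} → Ancestor m p d → Ancestor m q d → p < q → Ancestor m p q
  Ancestor-chain {d = d} = go (<-wellFounded d)
    where
    go : ∀ {m p q d} → Acc _<_ d → Ancestor m p d → Ancestor m q d → p < q → Ancestor m p q
    go (acc rs) a b p<q with Ancestor⇒Parent a | Ancestor⇒Parent b
    ... | r , R , ea | r′ , R′ , eb with Parent-unique R′ R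
    ... | refl with ea | eb
    ... | inj₁ refl | inj₁ refl = ⊥-elim (<-irrefl refl p<q)
    ... | inj₂ a′   | inj₁ refl = a′
    ... | inj₁ refl | inj₂ b′   = ⊥-elim (<-asym p<q (Ancestor⇒< b′))
    ... | inj₂ a′   | inj₂ b′   = go (rs (Parent⇒< R)) a′ b′ p<q

  Prior-trans : ∀ {m p q d} → Prior m p q → Prior m q d → Prior m p d
  Prior-trans {zero}  _ _ = tt
  Prior-trans {suc m} a b = a ++⁺ b

  Prior-chain : ∀ {m p q d} → Prior m p d → Prior m q d → p < q → Prior m p q
  Prior-chain {zero}  _ _ _ = tt
  Prior-chain {suc m} a b   = Ancestor-chain a b

  -- x is skipped on the parent chain from d down to l, so its entry is not
  -- below that of the next ancestor, which exceeds the entry of l.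
  Ancestor-entry<-intermediate : ∀ {k l x d} → Ancestor k l d → l < x → x < d → Prior k x d →
                                 e l k < e x k
  Ancestor-entry<-intermediate {d = d} = go (<-wellFounded d)
    where
    go : ∀ {k l x d} → Acc _<_ d → Ancestor k l d → l < x → x < d → Prior k x d → e l k < e x k
    go {k} {l} {x} (acc rs) a l<x x<d pr with Ancestor⇒Parent a
    ... | p , P , ea with <-cmp x p
    ... | tri> _ _ p<x =
      <-≤-trans (Ancestor⇒entry< a) (≮⇒≥ λ ex → proj₂ P x p<x x<d (x<d , Parent⇒bound P , ex , pr))
    ... | tri≈ _ refl _ with ea
    ...   | inj₁ refl = ⊥-elim (<-irrefl refl l<x)
    ...   | inj₂ a′   = Ancestor⇒entry< a′
    go (acc rs) a l<x x<d pr | p , P , ea | tri< x<p _ _ with ea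
    ...   | inj₁ refl = ⊥-elim (<-asym l<x x<p)
    ...   | inj₂ a′   = go (rs (Parent⇒< P)) a′ l<x x<p (Prior-chain pr (Parent⇒Prior P) x<p)

  mutual
    Prior? : ∀ m q d → Dec (Prior m q d)
    Prior? zero    q d = yes tt
    Prior? (suc m) q d = Ancestor? m q d

    Candidate? : ∀ m q d → Dec (Candidate m q d)
    Candidate? m q d with q <? d | d <? L | e q m <? e d m | Prior? m q d
    ... | yes a | yes b | yes c | yes g = yes (a , b , c , g)
    ... | no ¬a | _     | _     | _     = no λ x → ¬a (proj₁ x)
    ... | yes _ | no ¬b | _     | _     = no λ x → ¬b (proj₁ (proj₂ x))
    ... | yes _ | yes _ | no ¬c | _     = no λ x → ¬c (proj₁ (proj₂ (proj₂ x)))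
    ... | yes _ | yes _ | yes _ | no ¬g = no λ x → ¬g (proj₂ (proj₂ (proj₂ x)))

    parent? : ∀ m d → Dec (∃ λ p → Parent m p d)
    parent? m d with lastSatisfying (λ q → Candidate m q d) (λ q → Candidate? m q d) d
    ... | inj₁ (p , _ , c , after) = yes (p , c , after)
    ... | inj₂ none = no λ (p , P) → none p (Parent⇒< P) (proj₁ P)

    Ancestor? : ∀ m q d → Dec (Ancestor m q d)
    Ancestor? m q d = go (<-wellFounded d)
      where
      go : ∀ {d} → Acc _<_ d → Dec (Ancestor m q d)
      go {d} (acc rs) with parent? m d
      ... | no none = no λ a → none (_ , proj₁ (proj₂ (Ancestor⇒Parent a)))
      ... | yes (p , P) with <-cmp q p
      ...   | tri≈ _ refl _ = yes [ P ]
      ...   | tri> _ _ p<q  = no λ a → <⇒≱ p<q (Ancestor≤Parent a P)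
      ...   | tri< q<p _ _ with go (rs (Parent⇒< P))
      ...     | yes a = yes (a ∷ʳ P)
      ...     | no ¬a = no λ a → ¬a (ancestor-of-p a)
        where
        ancestor-of-p : Ancestor m q d → Ancestor m q p
        ancestor-of-p a with Ancestor⇒Parent a
        ... | p′ , P′ , ea rewrite Parent-unique P′ P with ea
        ... | inj₁ refl = ⊥-elim (<-irrefl refl q<p)
        ... | inj₂ a′   = a′

  Candidate⇒Parent : ∀ {m q d} → Candidate m q d → ∃ λ p → Parent m p d × q ≤ p
  Candidate⇒Parent {m} {q} {d} c with lastSatisfying (λ q → Candidate m q d) (λ q → Candidate? m q d) d
  ... | inj₁ (p , _ , c′ , after) = p , (c′ , after) , Candidate≤Parent c (c′ , after)
  ... | inj₂ none                 = ⊥-elim (none q (proj₁ c) c)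

  Ancestor-intermediate : ∀ {k l y d} → Ancestor k l d → l < y → y < d → Prior k y d → Ancestor k l y
  Ancestor-intermediate {y = y} = go (<-wellFounded y)
    where
    go : ∀ {k l y d} → Acc _<_ y → Ancestor k l d → l < y → y < d → Prior k y d → Ancestor k l y
    go (acc rs) a l<y y<d pr
      with Candidate⇒Parent (l<y , <-trans y<d (Ancestor⇒bound a) ,
                             Ancestor-entry<-intermediate a l<y y<d pr ,
                             Prior-chain (Ancestor⇒Prior a) pr l<y)
    ... | p , P , l≤p with m≤n⇒m<n∨m≡n l≤p
    ...   | inj₂ refl = [ P ]
    ...   | inj₁ l<p  = go (rs (Parent⇒< P)) a l<p (<-trans (Parent⇒< P) y<d)
                          (Prior-trans (Parent⇒Prior P) pr) ∷ʳ P

module Prefix (e₁ e₂ : ℕ → ℕ → ℕ) (L₁ L₂ N : ℕ) (agree : ∀ x m → x < N → e₁ x m ≡ e₂ x m)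
              (N≤L₁ : N ≤ L₁) (N≤L₂ : N ≤ L₂) where

  private
    module A₁ = Ancestry e₁ L₁
    module A₂ = Ancestry e₂ L₂

  mutual
    Prior₁⇒₂ : ∀ m {q d} → d < N → A₁.Prior m q d → A₂.Prior m q d
    Prior₁⇒₂ zero    _   _ = tt
    Prior₁⇒₂ (suc m) d<N a = Ancestor₁⇒₂ m d<N a

    Prior₂⇒₁ : ∀ m {q d} → d < N → A₂.Prior m q d → A₁.Prior m q d
    Prior₂⇒₁ zero    _   _ = tt
    Prior₂⇒₁ (suc m) d<N a = Ancestor₂⇒₁ m d<N a

    Candidate₁⇒₂ : ∀ m {q d} → d < N → A₁.Candidate m q d → A₂.Candidate m q d
    Candidate₁⇒₂ m {q} {d} d<N (q<d , _ , lt , pr) =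
      q<d , <-≤-trans d<N N≤L₂ , subst₂ _<_ (agree q m (<-trans q<d d<N)) (agree d m d<N) lt ,
      Prior₁⇒₂ m d<N pr

    Candidate₂⇒₁ : ∀ m {q d} → d < N → A₂.Candidate m q d → A₁.Candidate m q d
    Candidate₂⇒₁ m {q} {d} d<N (q<d , _ , lt , pr) =
      q<d , <-≤-trans d<N N≤L₁ , subst₂ _<_ (sym (agree q m (<-trans q<d d<N))) (sym (agree d m d<N)) lt ,
      Prior₂⇒₁ m d<N pr

    Parent₁⇒₂ : ∀ m {p d} → d < N → A₁.Parent m p d → A₂.Parent m p d
    Parent₁⇒₂ m d<N (c , after) =
      Candidate₁⇒₂ m d<N c , λ q p<q q<d c′ → after q p<q q<d (Candidate₂⇒₁ m d<N c′)

    Parent₂⇒₁ : ∀ m {p d} → d < N → A₂.Parent m p d → A₁.Parent m p d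
    Parent₂⇒₁ m d<N (c , after) =
      Candidate₂⇒₁ m d<N c , λ q p<q q<d c′ → after q p<q q<d (Candidate₁⇒₂ m d<N c′)

    Ancestor₁⇒₂ : ∀ m {p d} → d < N → A₁.Ancestor m p d → A₂.Ancestor m p d
    Ancestor₁⇒₂ m d<N [ x ]    = [ Parent₁⇒₂ m d<N x ]
    Ancestor₁⇒₂ m d<N (x ∷ xs) =
      Parent₁⇒₂ m (<-trans (A₁.Ancestor⇒< xs) d<N) x ∷ Ancestor₁⇒₂ m d<N xs

    Ancestor₂⇒₁ : ∀ m {p d} → d < N → A₂.Ancestor m p d → A₁.Ancestor m p d
    Ancestor₂⇒₁ m d<N [ x ]    = [ Parent₂⇒₁ m d<N x ]
    Ancestor₂⇒₁ m d<N (x ∷ xs) =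
      Parent₂⇒₁ m (<-trans (A₂.Ancestor⇒< xs) d<N) x ∷ Ancestor₂⇒₁ m d<N xs

nth-beyond : ∀ {X : Set} {d : X} xs i → length xs ≤ i → nth d xs i ≡ d
nth-beyond []       i       _         = refl
nth-beyond (x ∷ xs) (suc i) (s≤s xs≤i) = nth-beyond xs i xs≤i

nth-++ˡ : ∀ {X : Set} {d : X} xs ys i → i < length xs → nth d (xs ++ ys) i ≡ nth d xs i
nth-++ˡ (x ∷ xs) ys zero    _         = refl
nth-++ˡ (x ∷ xs) ys (suc i) (s≤s i<xs) = nth-++ˡ xs ys i i<xs

nth-++ʳ : ∀ {X : Set} {d : X} xs ys i → nth d (xs ++ ys) (length xs + i) ≡ nth d ys i
nth-++ʳ []       ys i = refl
nth-++ʳ (x ∷ xs) ys i = nth-++ʳ xs ys i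

nth-take : ∀ {X : Set} {d : X} k xs i → i < k → nth d (take k xs) i ≡ nth d xs i
nth-take (suc k) []       i       _        = refl
nth-take (suc k) (x ∷ xs) zero    _        = refl
nth-take (suc k) (x ∷ xs) (suc i) (s≤s i<k) = nth-take k xs i i<k

nth-drop : ∀ {X : Set} {d : X} k xs i → nth d (drop k xs) i ≡ nth d xs (k + i)
nth-drop zero    xs       i = refl
nth-drop (suc k) []       i = refl
nth-drop (suc k) (x ∷ xs) i = nth-drop k xs i

nth-map : ∀ {X Y : Set} (f : X → Y) {d : X} → ∀ xs i → nth (f d) (map f xs) i ≡ f (nth d xs i)
nth-map f []       i       = refl
nth-map f (x ∷ xs) zero    = refl
nth-map f (x ∷ xs) (suc i) = nth-map f xs i

length-concat-applyUpTo : ∀ {X : Set} (f : ℕ → List X) l → (∀ t → length (f t) ≡ l) →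
                          ∀ n → length (concat (applyUpTo f n)) ≡ n * l
length-concat-applyUpTo f l len zero    = refl
length-concat-applyUpTo f l len (suc n) =
  trans (length-++ (f 0)) (cong₂ _+_ (len 0) (length-concat-applyUpTo (f ∘ suc) l (len ∘ suc) n))

nth-concat-applyUpTo : ∀ {X : Set} {d : X} (f : ℕ → List X) l → (∀ t → length (f t) ≡ l) →
                       ∀ n t j → t < n → j < l → nth d (concat (applyUpTo f n)) (t * l + j) ≡ nth d (f t) j
nth-concat-applyUpTo f l len (suc n) zero    j _ j<l = nth-++ˡ (f 0) _ j (subst (j <_) (sym (len 0)) j<l)
nth-concat-applyUpTo {d = d} f l len (suc n) (suc t) j (s≤s t<n) j<l = begin
  nth d (f 0 ++ rest) (l + t * l + j)
    ≡⟨ cong (nth d (f 0 ++ rest)) (+-assoc l (t * l) j) ⟩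
  nth d (f 0 ++ rest) (l + (t * l + j))
    ≡⟨ cong (λ k → nth d (f 0 ++ rest) (k + (t * l + j))) (sym (len 0)) ⟩
  nth d (f 0 ++ rest) (length (f 0) + (t * l + j))
    ≡⟨ nth-++ʳ (f 0) rest (t * l + j) ⟩
  nth d rest (t * l + j)
    ≡⟨ nth-concat-applyUpTo (f ∘ suc) l (len ∘ suc) n t j t<n j<l ⟩
  nth d (f (suc t)) j
    ∎
  where
  open ≡-Reasoning
  rest = concat (applyUpTo (f ∘ suc) n)

nth-bumpFrom : ∀ up δ s D m → (length D ≤ m → δ (s + m) ≡ 0) →
  nth 0 (bumpFrom up δ s D) m ≡ nth 0 D m + (if up (s + m) then δ (s + m) else 0)
nth-bumpFrom up δ s [] m δ≡0 rewrite δ≡0 z≤n with up (s + m)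
... | true  = refl
... | false = refl
nth-bumpFrom up δ s (x ∷ D) zero _ rewrite +-identityʳ s with up s
... | true  = refl
... | false = sym (+-identityʳ x)
nth-bumpFrom up δ s (x ∷ D) (suc m) δ≡0 rewrite +-suc s m =
  nth-bumpFrom up δ (suc s) D m (λ D≤m → δ≡0 (s≤s D≤m))

length-blockFrom : ∀ A mm l0 asc i j Ds → length (blockFrom A mm l0 asc i j Ds) ≡ length Ds
length-blockFrom A mm l0 asc i j []       = refl
length-blockFrom A mm l0 asc i j (D ∷ Ds) = cong suc (length-blockFrom A mm l0 asc i (suc j) Ds)

nth-blockFrom : ∀ A mm l0 asc i j Ds k → k < length Ds →
  nth [] (blockFrom A mm l0 asc i j Ds) k ≡
  bumpFrom (λ m → below mm m ∧ asc (j + k) m) (λ m → i * (ent A (lastIdx A) m ∸ ent A l0 m)) 0 (nth [] Ds k)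
nth-blockFrom A mm l0 asc i j (D ∷ Ds) zero    _ rewrite +-identityʳ j = refl
nth-blockFrom A mm l0 asc i j (D ∷ Ds) (suc k) (s≤s k<Ds) rewrite +-suc j k =
  nth-blockFrom A mm l0 asc i (suc j) Ds k k<Ds

nth-dropLast : ∀ D m → lastIsZero D ≡ true → nth 0 (dropLast D) m ≡ nth 0 D m
nth-dropLast (x ∷ [])    zero    x≡0 = sym (≡ᵇ⇒≡ x 0 (subst T (sym x≡0) tt))
nth-dropLast (x ∷ [])    (suc m) _   = refl
nth-dropLast (x ∷ y ∷ D) zero    _   = refl
nth-dropLast (x ∷ y ∷ D) (suc m) z   = nth-dropLast (y ∷ D) m z

allB⇒col : ∀ p X x → allB p X ≡ true → x < length X → p (col X x) ≡ true
allB⇒col p (D ∷ X) zero    all _ with p D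
... | true = refl
allB⇒col p (D ∷ X) (suc x) all (s≤s x<X) with p D
... | true = allB⇒col p X x all x<X

ent-map-dropLast : ∀ X → allB lastIsZero X ≡ true → ∀ x m → ent (map dropLast X) x m ≡ ent X x m
ent-map-dropLast X zeros x m with x <? length X
... | yes x<X = trans (cong (λ D → nth 0 D m) (nth-map dropLast {d = []} X x))
                      (nth-dropLast (col X x) m (allB⇒col lastIsZero X x zeros x<X))
... | no x≮X rewrite nth-map dropLast {d = []} X x | nth-beyond {d = []} X x (≮⇒≥ x≮X) = refl

length-trim : ∀ f X → length (trim f X) ≡ length X
length-trim zero    X = refl
length-trim (suc f) X with allB lastIsZero X
... | true  = trans (length-trim f (map dropLast X)) (length-map dropLast X)
... | false = refl

ent-trim : ∀ f X x m → ent (trim f X) x m ≡ ent X x m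
ent-trim zero    X x m = refl
ent-trim (suc f) X x m with allB lastIsZero X in zeros
... | true  = trans (ent-trim f (map dropLast X) x m) (ent-map-dropLast X zeros x m)
... | false = refl

All⇒col : ∀ {P : Column → Set} (X : Array) x → All P X → x < length X → P (col X x)
All⇒col (D ∷ X) zero    (p ∷ _)  _         = p
All⇒col (D ∷ X) (suc x) (_ ∷ ps) (s≤s x<X) = All⇒col X x ps x<X

ent<⇒<height : ∀ X {q d m} → ent X q m < ent X d m → m < length (col X d)
ent<⇒<height X {q} {d} {m} lt with m <? length (col X d)
... | yes m<h = m<h
... | no m≮h with subst (ent X q m <_) (nth-beyond (col X d) m (≮⇒≥ m≮h)) lt
...   | ()

module ArrayAncestry (X : Array) where

  private
    module AX = Ancestry (ent X) (length X)

  mutual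
    Prev⇒Prior : ∀ m {q d} → Prev X m q d → AX.Prior m q d
    Prev⇒Prior zero    _ = tt
    Prev⇒Prior (suc m) a = Anc⇒Ancestor m a

    Prior⇒Prev : ∀ m {q d} → AX.Prior m q d → Prev X m q d
    Prior⇒Prev zero    _ = tt
    Prior⇒Prev (suc m) a = Ancestor⇒Anc m a

    Cand⇒Candidate : ∀ m {q d} → Cand X m q d → AX.Candidate m q d
    Cand⇒Candidate m (q<d , d<X , _ , lt , pr) = q<d , d<X , lt , Prev⇒Prior m pr

    Candidate⇒Cand : ∀ m {q d} → AX.Candidate m q d → Cand X m q d
    Candidate⇒Cand m (q<d , d<X , lt , pr) = q<d , d<X , ent<⇒<height X lt , lt , Prior⇒Prev m pr

    Par⇒Parent : ∀ m {p d} → Par X m p d → AX.Parent m p d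
    Par⇒Parent m (c , after) = Cand⇒Candidate m c , λ q p<q q<d c′ → after q p<q q<d (Candidate⇒Cand m c′)

    Parent⇒Par : ∀ m {p d} → AX.Parent m p d → Par X m p d
    Parent⇒Par m (c , after) = Candidate⇒Cand m c , λ q p<q q<d c′ → after q p<q q<d (Cand⇒Candidate m c′)

    Anc⇒Ancestor : ∀ m {p d} → Anc X m p d → AX.Ancestor m p d
    Anc⇒Ancestor m [ x ]    = [ Par⇒Parent m x ]
    Anc⇒Ancestor m (x ∷ xs) = Par⇒Parent m x ∷ Anc⇒Ancestor m xs

    Ancestor⇒Anc : ∀ m {p d} → AX.Ancestor m p d → Anc X m p d
    Ancestor⇒Anc m [ x ]    = [ Parent⇒Par m x ]
    Ancestor⇒Anc m (x ∷ xs) = Parent⇒Par m x ∷ Ancestor⇒Anc m xs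

-- A = G + B0 + (C) through its entries a: C is column last, B0 occupies the
-- columns l0 + j for j < l1, and l0 is the m0-parent of C.
module Expansion (a : ℕ → ℕ → ℕ) (last l0 l1 m0 : ℕ) (l0+l1≡last : l0 + l1 ≡ last) (0<l1 : 0 < l1)
                 (m0-parent : Ancestry.Parent a (suc last) m0 l0 last) where

  module A = Ancestry a (suc last)

  Descends : ℕ → ℕ → Set
  Descends m j = j ≡ 0 ⊎ A.Ancestor m l0 (l0 + j)

  Ascends : ℕ → ℕ → Set
  Ascends j m = m < m0 × Descends m j

  δ : ℕ → ℕ
  δ m = a last m ∸ a l0 m

  -- The only columns whose parents in A[n] are not copies of parents in A:
  -- for k < m0 the first column of B_(t+1) takes the role of C.
  Regular : ℕ → ℕ → Set
  Regular k j = 0 < j ⊎ m0 ≤ k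

  Regular? : ∀ k j → Regular k j ⊎ (j ≡ 0 × k < m0)
  Regular? k (suc j) = inj₁ (inj₁ z<s)
  Regular? k zero with m0 ≤? k
  ... | yes m0≤k = inj₁ (inj₂ m0≤k)
  ... | no m0≰k  = inj₂ (refl , ≰⇒> m0≰k)

  l0<last : l0 < last
  l0<last = A.Parent⇒< m0-parent

  l0+j<last : ∀ {j} → j < l1 → l0 + j < last
  l0+j<last j<l1 = subst (_ <_) l0+l1≡last (+-monoʳ-< l0 j<l1)

  inB0 : ∀ {p} → l0 ≤ p → p < last → ∃ λ j → j < l1 × p ≡ l0 + j
  inB0 {p} l0≤p p<last =
    p ∸ l0 , +-cancelˡ-< l0 _ _ (subst₂ _<_ (sym (m+[n∸m]≡n l0≤p)) (sym l0+l1≡last) p<last) ,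
    sym (m+[n∸m]≡n l0≤p)

  a-l0+0 : ∀ m → a (l0 + 0) m ≡ a l0 m
  a-l0+0 m = cong (λ x → a x m) (+-identityʳ l0)

  l0-Ancestor-last : ∀ {k} → k ≤ m0 → A.Ancestor k l0 last
  l0-Ancestor-last k≤m0 = A.Ancestor-antimono k≤m0 [ m0-parent ]

  last-parent : ∀ {k} → k < m0 → ∃ λ i → i < l1 × A.Parent k (l0 + i) last
  last-parent k<m0 with A.Ancestor⇒Parent (l0-Ancestor-last (<⇒≤ k<m0))
  ... | p , P , _ with inB0 (A.Ancestor≤Parent (l0-Ancestor-last (<⇒≤ k<m0)) P) (A.Parent⇒< P)
  ...   | i , i<l1 , refl = i , i<l1 , P

  Ascends? : ∀ j m → Dec (Ascends j m)
  Ascends? j m with m <? m0 | j ≟ 0 | A.Ancestor? m l0 (l0 + j)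
  ... | no m≮m0  | _       | _      = no (m≮m0 ∘ proj₁)
  ... | yes m<m0 | yes j≡0 | _      = yes (m<m0 , inj₁ j≡0)
  ... | yes m<m0 | no _    | yes an = yes (m<m0 , inj₂ an)
  ... | yes _    | no j≢0  | no ¬an = no λ { (_ , inj₁ j≡0) → j≢0 j≡0 ; (_ , inj₂ an) → ¬an an }

  Regular-Ascends⇒Ancestor : ∀ {k j} → Regular k j → Ascends j k → A.Ancestor k l0 (l0 + j)
  Regular-Ascends⇒Ancestor _            (_ , inj₂ an)        = an
  Regular-Ascends⇒Ancestor (inj₁ 0<j)   (_ , inj₁ refl)      = ⊥-elim (<-irrefl refl 0<j)
  Regular-Ascends⇒Ancestor (inj₂ m0≤k)  (k<m0 , inj₁ refl)   = ⊥-elim (<⇒≱ k<m0 m0≤k)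

  Ascends-intermediate : ∀ {k i j} → Regular k j → i < j → A.Prior k (l0 + i) (l0 + j) →
                         Ascends j k → Ascends i k
  Ascends-intermediate {i = zero}  _   _   _  (k<m0 , _) = k<m0 , inj₁ refl
  Ascends-intermediate {i = suc i} reg i<j pr asc =
    proj₁ asc , inj₂ (A.Ancestor-intermediate (Regular-Ascends⇒Ancestor reg asc) (m<m+n l0 z<s) (+-monoʳ-< l0 i<j) pr)

  Ascends-parent : ∀ {k i j} → A.Parent k (l0 + i) (l0 + j) → Ascends i k → Ascends j k
  Ascends-parent {j = j} P (k<m0 , inj₁ refl) =
    k<m0 , inj₂ [ subst (λ x → A.Parent _ x (l0 + j)) (+-identityʳ l0) P ]
  Ascends-parent         P (k<m0 , inj₂ an)   = k<m0 , inj₂ (an ∷ʳ P)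

  Ascends-toward-last : ∀ {k i} → k < m0 → i < l1 → A.Prior k (l0 + i) last → Ascends i k
  Ascends-toward-last {i = zero}  k<m0 _    _  = k<m0 , inj₁ refl
  Ascends-toward-last {i = suc i} k<m0 i<l1 pr =
    k<m0 , inj₂ (A.Ancestor-intermediate (l0-Ancestor-last (<⇒≤ k<m0)) (m<m+n l0 z<s) (l0+j<last i<l1) pr)

  block-end : ∀ {t j} → j < l1 → t * l1 + j < suc t * l1
  block-end {t} {j} j<l1 = subst (t * l1 + j <_) (+-comm (t * l1) l1) (+-monoʳ-< (t * l1) j<l1)

  -- Column j of B_t sits at index slot t j of A[n]; opaque to keep the
  -- arithmetic from unfolding in the ancestry arguments.
  opaque
    slot : ℕ → ℕ → ℕ
    slot t j = l0 + (t * l1 + j)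

    slot≡ : ∀ t j → slot t j ≡ l0 + (t * l1 + j)
    slot≡ t j = refl

    slot-zero : ∀ {j} → slot 0 j ≡ l0 + j
    slot-zero = refl

    l0≤slot : ∀ t j → l0 ≤ slot t j
    l0≤slot t j = m≤m+n l0 _

    slot-<ʳ : ∀ {t j j′} → j < j′ → slot t j < slot t j′
    slot-<ʳ {t} j<j′ = +-monoʳ-< l0 (+-monoʳ-< (t * l1) j<j′)

    slot-≤ʳ : ∀ {t j j′} → j ≤ j′ → slot t j ≤ slot t j′
    slot-≤ʳ {t} j≤j′ = +-monoʳ-≤ l0 (+-monoʳ-≤ (t * l1) j≤j′)

    slot-<-block : ∀ {s t j j′} → s < t → j < l1 → slot s j < slot t j′
    slot-<-block {s} {t} {j} {j′} s<t j<l1 =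
      +-monoʳ-< l0 (<-≤-trans (block-end {s} j<l1) (≤-trans (*-monoˡ-≤ l1 s<t) (m≤m+n (t * l1) j′)))

    slot-bound : ∀ {t j} → j < l1 → slot t j < l0 + suc t * l1
    slot-bound {t} j<l1 = +-monoʳ-< l0 (block-end {t} j<l1)

    slot-<⁻¹ : ∀ {s t j j′} → j < l1 → j′ < l1 → slot s j < slot t j′ → s < t ⊎ (s ≡ t × j < j′)
    slot-<⁻¹ {s} {t} j<l1 j′<l1 lt with <-cmp s t
    ... | tri< s<t _ _  = inj₁ s<t
    ... | tri≈ _ refl _ = inj₂ (refl , +-cancelˡ-< (s * l1) _ _ (+-cancelˡ-< l0 _ _ lt))
    ... | tri> _ _ t<s  = ⊥-elim (<-asym lt (slot-<-block t<s j′<l1))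

    slot-injective : ∀ {s t j j′} → j < l1 → j′ < l1 → slot s j ≡ slot t j′ → s ≡ t × j ≡ j′
    slot-injective {s} {t} j<l1 j′<l1 eq with <-cmp s t
    ... | tri< s<t _ _  = ⊥-elim (<-irrefl eq (slot-<-block s<t j<l1))
    ... | tri≈ _ refl _ = refl , +-cancelˡ-≡ (s * l1) _ _ (+-cancelˡ-≡ l0 _ _ eq)
    ... | tri> _ _ t<s  = ⊥-elim (<-irrefl (sym eq) (slot-<-block t<s j′<l1))

    G-or-slot : ∀ q → q < l0 ⊎ ∃₂ λ s j → j < l1 × q ≡ slot s j
    G-or-slot q with q <? l0
    ... | yes q<l0 = inj₁ q<l0
    ... | no q≮l0  = inj₂ ((q ∸ l0) / l1 , (q ∸ l0) % l1 , m%n<n (q ∸ l0) l1 , (begin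
          q                                        ≡⟨ m+[n∸m]≡n (≮⇒≥ q≮l0) ⟨
          l0 + (q ∸ l0)                            ≡⟨ cong (l0 +_) (m≡m%n+[m/n]*n (q ∸ l0) l1) ⟩
          l0 + ((q ∸ l0) % l1 + (q ∸ l0) / l1 * l1) ≡⟨ cong (l0 +_) (+-comm ((q ∸ l0) % l1) _) ⟩
          l0 + ((q ∸ l0) / l1 * l1 + (q ∸ l0) % l1) ∎))
      where
      open ≡-Reasoning
      instance
        l1≢0 : NonZero l1
        l1≢0 = >-nonZero 0<l1

  -- p is the copy in B_t of column p′ of G + B0 (columns of G are fixed)
  data Image (t p′ p : ℕ) : Set where
    fixed   : p′ < l0 → p ≡ p′ → Image t p′ p
    shifted : ∀ {i} → i < l1 → p′ ≡ l0 + i → p ≡ slot t i → Image t p′ p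

  image : ∀ t p′ → p′ < last → ∃ λ p → Image t p′ p
  image t p′ p′<last with p′ <? l0
  ... | yes p′<l0 = p′ , fixed p′<l0 refl
  ... | no p′≮l0 with inB0 (≮⇒≥ p′≮l0) p′<last
  ...   | i , i<l1 , p′≡ = slot t i , shifted i<l1 p′≡ refl

  Image-zero : ∀ {p′ p} → Image 0 p′ p → p ≡ p′
  Image-zero (fixed _ p≡p′)        = p≡p′
  Image-zero (shifted _ p′≡ p≡)    = trans p≡ (trans slot-zero (sym p′≡))

  Image-G : ∀ {t p′ p} → p′ < l0 → Image t p′ p → p ≡ p′
  Image-G _    (fixed _ p≡p′)            = p≡p′
  Image-G p′<l0 (shifted {i} _ refl _)   = ⊥-elim (<-irrefl refl (<-≤-trans p′<l0 (m≤m+n l0 i)))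

  Image-B0 : ∀ {t p′ p i} → p′ ≡ l0 + i → Image t p′ p → p ≡ slot t i
  Image-B0 {i = i} refl (fixed p′<l0 _) = ⊥-elim (<-irrefl refl (<-≤-trans p′<l0 (m≤m+n l0 i)))
  Image-B0 refl (shifted _ e p≡) with +-cancelˡ-≡ l0 _ _ e
  ... | refl = p≡

  -- where an r-ancestor q in A[n] of column j of B_t can lie
  data AncestorShape (r t j q : ℕ) : Set where
    in-G          : q < l0 → A.Ancestor r q (l0 + j) → AncestorShape r t j q
    same-block    : ∀ {i} → i < l1 → q ≡ slot t i → A.Ancestor r (l0 + i) (l0 + j) → AncestorShape r t j q
    earlier-block : ∀ {s i} → Descends r j → r < m0 → s < t → i < l1 → q ≡ slot s i →
                    A.Ancestor r (l0 + i) last → AncestorShape r t j q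

  AncestorShape-extend : ∀ {r t i j q} → A.Parent r (l0 + i) (l0 + j) → AncestorShape r t i q → AncestorShape r t j q
  AncestorShape-extend P (in-G q<l0 a)           = in-G q<l0 (a ∷ʳ P)
  AncestorShape-extend P (same-block i<l1 q≡ a)  = same-block i<l1 q≡ (a ∷ʳ P)
  AncestorShape-extend {r} {j = j} P (earlier-block (inj₁ refl) r<m0 s<t i<l1 q≡ a) =
    earlier-block (inj₂ [ subst (λ x → A.Parent r x (l0 + j)) (+-identityʳ l0) P ]) r<m0 s<t i<l1 q≡ a
  AncestorShape-extend P (earlier-block (inj₂ d) r<m0 s<t i<l1 q≡ a) =
    earlier-block (inj₂ (d ∷ʳ P)) r<m0 s<t i<l1 q≡ a

  data PriorShape (k t j q : ℕ) : Set where
    in-G          : q < l0 → A.Prior k q (l0 + j) → PriorShape k t j q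
    same-block    : ∀ {i} → i < l1 → i < j → q ≡ slot t i → A.Prior k (l0 + i) (l0 + j) → PriorShape k t j q
    earlier-block : ∀ {s i} → (j ≡ 0 ⊎ A.Prior k l0 (l0 + j)) → k ≤ m0 → s < t → i < l1 →
                    q ≡ slot s i → A.Prior k (l0 + i) last → PriorShape k t j q

  data CandidateShape (k t j q : ℕ) : Set where
    in-G          : q < l0 → A.Candidate k q (l0 + j) ⊎ A.Ancestor k l0 (l0 + j) → CandidateShape k t j q
    same-block    : ∀ {i} → i < l1 → q ≡ slot t i → A.Candidate k (l0 + i) (l0 + j) → CandidateShape k t j q
    earlier-block : ∀ {s i} → s < t → i < l1 → q ≡ slot s i → A.Candidate k l0 (l0 + j) →
                    CandidateShape k t j q

  CandidateShape⇒Candidate : ∀ {k t j q} → CandidateShape k t j q → ∃ λ q′ → A.Candidate k q′ (l0 + j)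
  CandidateShape⇒Candidate (in-G _ (inj₁ c))      = _ , c
  CandidateShape⇒Candidate (in-G _ (inj₂ a))      = _ , A.Ancestor⇒Candidate a
  CandidateShape⇒Candidate (same-block _ _ c)     = _ , c
  CandidateShape⇒Candidate (earlier-block _ _ _ c) = _ , c

  module Expanded (b : ℕ → ℕ → ℕ) (len n : ℕ) (len≡ : len ≡ l0 + suc n * l1)
                  (b≡a : ∀ x m → x < last → b x m ≡ a x m)
                  (b-ascending : ∀ t j m → t ≤ n → j < l1 → Ascends j m →
                                 b (l0 + (t * l1 + j)) m ≡ a (l0 + j) m + t * δ m)
                  (b-fixed : ∀ t j m → t ≤ n → j < l1 → ¬ Ascends j m →
                             b (l0 + (t * l1 + j)) m ≡ a (l0 + j) m)
                  where

    module E = Ancestry b len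

    last≤len : last ≤ len
    last≤len = subst₂ _≤_ l0+l1≡last (sym len≡) (+-monoʳ-≤ l0 (m≤m+n l1 (n * l1)))

    module AE = Prefix a b (suc last) len last (λ x m x<last → sym (b≡a x m x<last)) (n≤1+n last) last≤len

    opaque
      unfolding slot

      entry-ascending : ∀ {t j m} → t ≤ n → j < l1 → Ascends j m → b (slot t j) m ≡ a (l0 + j) m + t * δ m
      entry-ascending t≤n j<l1 = b-ascending _ _ _ t≤n j<l1

      entry-fixed : ∀ {t j m} → t ≤ n → j < l1 → ¬ Ascends j m → b (slot t j) m ≡ a (l0 + j) m
      entry-fixed t≤n j<l1 = b-fixed _ _ _ t≤n j<l1

    slot<len : ∀ {t j} → t ≤ n → j < l1 → slot t j < len
    slot<len {t} {j} t≤n j<l1 =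
      subst (slot t j <_) (sym len≡) (<-≤-trans (slot-bound j<l1) (+-monoʳ-≤ l0 (*-monoˡ-≤ l1 (s≤s t≤n))))

    a≤b : ∀ {t j m} → t ≤ n → j < l1 → a (l0 + j) m ≤ b (slot t j) m
    a≤b {t} {j} {m} t≤n j<l1 with Ascends? j m
    ... | yes asc = subst (_ ≤_) (sym (entry-ascending t≤n j<l1 asc)) (m≤m+n _ _)
    ... | no ¬asc = ≤-reflexive (sym (entry-fixed t≤n j<l1 ¬asc))

    -- below row m0 the first column of B_(t+1) is C, shifted as B_t is
    first-entry : ∀ {t k} → suc t ≤ n → k < m0 → b (slot (suc t) 0) k ≡ a last k + t * δ k
    first-entry {t} {k} t<n k<m0 = begin
      b (slot (suc t) 0) k           ≡⟨ entry-ascending t<n 0<l1 (k<m0 , inj₁ refl) ⟩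
      a (l0 + 0) k + suc t * δ k     ≡⟨ cong (_+ suc t * δ k) (a-l0+0 k) ⟩
      a l0 k + (δ k + t * δ k)       ≡⟨ +-assoc (a l0 k) (δ k) (t * δ k) ⟨
      a l0 k + δ k + t * δ k         ≡⟨ cong (_+ t * δ k) (m+[n∸m]≡n a-l0≤a-last) ⟩
      a last k + t * δ k             ∎
      where
      open ≡-Reasoning
      a-l0≤a-last : a l0 k ≤ a last k
      a-l0≤a-last = <⇒≤ (A.Ancestor⇒entry< (l0-Ancestor-last (<⇒≤ k<m0)))

    shift-preserves-< : ∀ {t i j k} → t ≤ n → i < l1 → j < l1 → (Ascends i k → Ascends j k) →
                        (Ascends j k → Ascends i k) → a (l0 + i) k < a (l0 + j) k → b (slot t i) k < b (slot t j) k
    shift-preserves-< {t} {i} {j} {k} t≤n i<l1 j<l1 i⇒j j⇒i lt with Ascends? j k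
    ... | yes asc = subst₂ _<_ (sym (entry-ascending t≤n i<l1 (j⇒i asc))) (sym (entry-ascending t≤n j<l1 asc))
                      (+-monoˡ-< (t * δ k) lt)
    ... | no ¬asc = subst₂ _<_ (sym (entry-fixed t≤n i<l1 (¬asc ∘ i⇒j))) (sym (entry-fixed t≤n j<l1 ¬asc)) lt

    shift-reflects-< : ∀ {t i j k} → t ≤ n → i < l1 → j < l1 → (Ascends j k → Ascends i k) →
                       b (slot t i) k < b (slot t j) k → a (l0 + i) k < a (l0 + j) k
    shift-reflects-< {t} {i} {j} {k} t≤n i<l1 j<l1 j⇒i lt with Ascends? j k | Ascends? i k
    ... | yes asc | _ = +-cancelʳ-< (t * δ k) _ _
                          (subst₂ _<_ (entry-ascending t≤n i<l1 (j⇒i asc)) (entry-ascending t≤n j<l1 asc) lt)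
    ... | no ¬asc | yes ascᵢ = ≤-<-trans (m≤m+n _ _)
                                 (subst₂ _<_ (entry-ascending t≤n i<l1 ascᵢ) (entry-fixed t≤n j<l1 ¬asc) lt)
    ... | no ¬asc | no ¬ascᵢ = subst₂ _<_ (entry-fixed t≤n i<l1 ¬ascᵢ) (entry-fixed t≤n j<l1 ¬asc) lt

    a-l0≤b : ∀ {k s i} → k ≤ m0 → s ≤ n → i < l1 → A.Prior k (l0 + i) last → a l0 k ≤ b (slot s i) k
    a-l0≤b {k} k≤m0 s≤n i<l1 pr = ≤-trans (a-l0≤a i<l1 pr) (a≤b s≤n i<l1)
      where
      a-l0≤a : ∀ {i} → i < l1 → A.Prior k (l0 + i) last → a l0 k ≤ a (l0 + i) k
      a-l0≤a {zero}  _    _  = ≤-reflexive (sym (a-l0+0 k))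
      a-l0≤a {suc i} i<l1 pr =
        <⇒≤ (A.Ancestor-entry<-intermediate (l0-Ancestor-last k≤m0) (m<m+n l0 z<s) (l0+j<last i<l1) pr)

    -- The invariant of the row-by-row induction: parents in A[n] are the
    -- images of parents in A, except that below m0 the first column of
    -- B_(t+1) has the image in B_t of the parent of C.
    record ParentsAt (r : ℕ) : Set where
      field
        parent-image    : ∀ {t j p′ p} → t ≤ n → j < l1 → Regular r j → A.Parent r p′ (l0 + j) →
                          Image t p′ p → E.Parent r p (slot t j)
        parent-preimage : ∀ {t j p} → t ≤ n → j < l1 → Regular r j → E.Parent r p (slot t j) →
                          ∃ λ p′ → A.Parent r p′ (l0 + j) × Image t p′ p
        parent-first    : ∀ {t i} → suc t ≤ n → r < m0 → i < l1 → A.Parent r (l0 + i) last →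
                          E.Parent r (slot t i) (slot (suc t) 0)
        parent-first⁻¹  : ∀ {t p} → suc t ≤ n → r < m0 → E.Parent r p (slot (suc t) 0) →
                          ∃ λ i → i < l1 × A.Parent r (l0 + i) last × p ≡ slot t i

    record PriorsAt (k : ℕ) : Set where
      field
        prior-image : ∀ {t j p′ p} → t ≤ n → j < l1 → A.Prior k p′ (l0 + j) → Image t p′ p →
                      E.Prior k p (slot t j)
        prior-first : ∀ {t i} → suc t ≤ n → k < m0 → i < l1 → A.Prior k (l0 + i) last →
                      E.Prior k (slot t i) (slot (suc t) 0)
        prior-shape : ∀ {t j q} → t ≤ n → j < l1 → q < slot t j → E.Prior k q (slot t j) → PriorShape k t j q

    module FromParents (r : ℕ) (R : ParentsAt r) where
      open ParentsAt R

      Ancestor-image : ∀ {t j p′ p} → t ≤ n → j < l1 → A.Ancestor r p′ (l0 + j) → Image t p′ p →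
                       E.Ancestor r p (slot t j)
      Ancestor-image {t} {j} = go (<-wellFounded (slot t j))
        where
        go : ∀ {t j p′ p} → Acc _<_ (slot t j) → t ≤ n → j < l1 → A.Ancestor r p′ (l0 + j) →
             Image t p′ p → E.Ancestor r p (slot t j)
        go {zero} {j} {p′} _ _ j<l1 a im rewrite Image-zero im =
          subst (E.Ancestor r p′) (sym slot-zero) (AE.Ancestor₁⇒₂ r (l0+j<last j<l1) a)
        go {suc t} {j} {p′} {p} (acc rs) t≤n j<l1 a im with Regular? r j
        ... | inj₁ reg = viaParent (A.Ancestor⇒Parent a)
          where
          viaParent : (∃ λ p₁ → A.Parent r p₁ (l0 + j) × A.AncestorOrSelf r p′ p₁) →
                      E.Ancestor r p (slot (suc t) j)
          viaParent (p₁ , P₁ , ea) with p₁ <? l0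
          ... | yes p₁<l0 with Image-G (≤-<-trans (A.AncestorOrSelf⇒≤ ea) p₁<l0) im | ea
          ...   | refl | inj₁ refl = [ parent-image t≤n j<l1 reg P₁ (fixed p₁<l0 refl) ]
          ...   | refl | inj₂ a′   =
            AE.Ancestor₁⇒₂ r (<-trans p₁<l0 l0<last) a′ ∷ʳ parent-image t≤n j<l1 reg P₁ (fixed p₁<l0 refl)
          viaParent (p₁ , P₁ , ea) | no p₁≮l0
            with inB0 (≮⇒≥ p₁≮l0) (<-trans (A.Parent⇒< P₁) (l0+j<last j<l1))
          ... | i , i<l1 , refl with ea
          ...   | inj₁ refl rewrite Image-B0 {i = i} refl im =
            [ parent-image t≤n j<l1 reg P₁ (shifted i<l1 refl refl) ]
          ...   | inj₂ a′ = go (rs (slot-<ʳ (+-cancelˡ-< l0 _ _ (A.Parent⇒< P₁)))) t≤n i<l1 a′ im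
                              ∷ʳ parent-image t≤n j<l1 reg P₁ (shifted i<l1 refl refl)
        ... | inj₂ (refl , r<m0) with last-parent r<m0
        ...   | i , i<l1 , Pi = subst (λ x → E.Ancestor r x (slot (suc t) 0)) (sym (Image-G p′<l0 im))
            (go (rs (slot-<-block ≤-refl i<l1)) (<⇒≤ t≤n) i<l1 p′→i (fixed p′<l0 refl)
             ∷ʳ parent-first t≤n r<m0 i<l1 Pi)
          where
          a′ : A.Ancestor r p′ l0
          a′ = subst (A.Ancestor r p′) (+-identityʳ l0) a
          p′<l0 : p′ < l0
          p′<l0 = A.Ancestor⇒< a′
          p′→i : A.Ancestor r p′ (l0 + i)
          p′→i = A.Ancestor-chain (a′ ++⁺ l0-Ancestor-last (<⇒≤ r<m0)) [ Pi ]
                                  (<-≤-trans p′<l0 (m≤m+n l0 i))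

      Ancestor-shape : ∀ {t j q} → t ≤ n → j < l1 → E.Ancestor r q (slot t j) → AncestorShape r t j q
      Ancestor-shape {t} {j} = go (<-wellFounded (slot t j))
        where
        go : ∀ {t j q} → Acc _<_ (slot t j) → t ≤ n → j < l1 → E.Ancestor r q (slot t j) →
             AncestorShape r t j q
        go {zero} {j} {q} _ _ j<l1 e
          with q <? l0 | AE.Ancestor₂⇒₁ r (l0+j<last j<l1) (subst (E.Ancestor r q) slot-zero e)
        ... | yes q<l0 | a = in-G q<l0 a
        ... | no q≮l0  | a with inB0 (≮⇒≥ q≮l0) (<-trans (A.Ancestor⇒< a) (l0+j<last j<l1))
        ...   | i , _ , refl = same-block (<-trans (+-cancelˡ-< l0 _ _ (A.Ancestor⇒< a)) j<l1) (sym slot-zero) a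
        go {suc t} {j} {q} (acc rs) t≤n j<l1 e with Regular? r j
        ... | inj₁ reg = viaParent (E.Ancestor⇒Parent e)
          where
          viaParent : (∃ λ p → E.Parent r p (slot (suc t) j) × E.AncestorOrSelf r q p) → AncestorShape r (suc t) j q
          viaParent (p , P , eq) with parent-preimage t≤n j<l1 reg P
          ... | p′ , P′ , fixed p′<l0 refl with eq
          ...   | inj₁ refl = in-G p′<l0 [ P′ ]
          ...   | inj₂ e′   =
            in-G (<-trans (E.Ancestor⇒< e′) p′<l0) (AE.Ancestor₂⇒₁ r (<-trans p′<l0 l0<last) e′ ∷ʳ P′)
          viaParent (p , P , eq) | p′ , P′ , shifted i<l1 refl refl with eq
          ...   | inj₁ refl = same-block i<l1 refl [ P′ ]
          ...   | inj₂ e′   =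
            AncestorShape-extend P′ (go (rs (slot-<ʳ (+-cancelˡ-< l0 _ _ (A.Parent⇒< P′)))) t≤n i<l1 e′)
        ... | inj₂ (refl , r<m0) = viaParent (E.Ancestor⇒Parent e)
          where
          viaParent : (∃ λ p → E.Parent r p (slot (suc t) 0) × E.AncestorOrSelf r q p) → AncestorShape r (suc t) 0 q
          viaParent (p , P , eq) with parent-first⁻¹ t≤n r<m0 P
          ... | i , i<l1 , Pi , refl with eq
          ...   | inj₁ refl = earlier-block (inj₁ refl) r<m0 ≤-refl i<l1 refl [ Pi ]
          ...   | inj₂ e′ with go (rs (slot-<-block ≤-refl i<l1)) (<⇒≤ t≤n) i<l1 e′
          ...     | in-G q<l0 a = in-G q<l0 (subst (A.Ancestor r q) (sym (+-identityʳ l0))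
                                   (A.Ancestor-chain (a ∷ʳ Pi) (l0-Ancestor-last (<⇒≤ r<m0)) q<l0))
          ...     | same-block i′<l1 q≡ a = earlier-block (inj₁ refl) r<m0 ≤-refl i′<l1 q≡ (a ∷ʳ Pi)
          ...     | earlier-block _ _ s<t i′<l1 q≡ a = earlier-block (inj₁ refl) r<m0 (m<n⇒m<1+n s<t) i′<l1 q≡ a

      Ancestor-first : ∀ {t i} → suc t ≤ n → r < m0 → i < l1 → A.Ancestor r (l0 + i) last →
                       E.Ancestor r (slot t i) (slot (suc t) 0)
      Ancestor-first {t} {i} t<n r<m0 i<l1 a with A.Ancestor⇒Parent a
      ... | p₁ , P₁ , ea with inB0 (A.Ancestor≤Parent (l0-Ancestor-last (<⇒≤ r<m0)) P₁) (A.Parent⇒< P₁)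
      ...   | i₁ , i₁<l1 , refl with ea
      ...     | inj₁ e rewrite +-cancelˡ-≡ l0 _ _ e = [ parent-first t<n r<m0 i₁<l1 P₁ ]
      ...     | inj₂ a′ =
        Ancestor-image (<⇒≤ t<n) i₁<l1 a′ (shifted i<l1 refl refl) ∷ʳ parent-first t<n r<m0 i₁<l1 P₁

    priorsAt-zero : PriorsAt 0
    priorsAt-zero = record { prior-image = λ _ _ _ _ → _ ; prior-first = λ _ _ _ _ → _ ; prior-shape = shape }
      where
      shape : ∀ {t j q} → t ≤ n → j < l1 → q < slot t j → E.Prior 0 q (slot t j) → PriorShape 0 t j q
      shape {t} {j} {q} _ j<l1 q<y _ with G-or-slot q
      ... | inj₁ q<l0 = in-G q<l0 _
      ... | inj₂ (s , i , i<l1 , refl) with slot-<⁻¹ i<l1 j<l1 q<y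
      ...   | inj₁ s<t          = earlier-block (inj₂ _) z≤n s<t i<l1 refl _
      ...   | inj₂ (refl , i<j) = same-block i<l1 i<j refl _

    priorsAt-suc : ∀ r → ParentsAt r → PriorsAt (suc r)
    priorsAt-suc r R = record
      { prior-image = Ancestor-image
      ; prior-first = λ t<n 1+r<m0 → Ancestor-first t<n (<-trans (n<1+n r) 1+r<m0)
      ; prior-shape = shape
      }
      where
      open FromParents r R
      shape : ∀ {t j q} → t ≤ n → j < l1 → q < slot t j → E.Ancestor r q (slot t j) → PriorShape (suc r) t j q
      shape t≤n j<l1 _ e with Ancestor-shape t≤n j<l1 e
      ... | in-G q<l0 a                         = in-G q<l0 a
      ... | same-block i<l1 q≡ a                = same-block i<l1 (+-cancelˡ-< l0 _ _ (A.Ancestor⇒< a)) q≡ a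
      ... | earlier-block d r<m0 s<t i<l1 q≡ a = earlier-block d r<m0 s<t i<l1 q≡ a

    module FromPriors (k : ℕ) (RP : PriorsAt k) where
      open PriorsAt RP

      Candidate-shape : ∀ {t j q} → t ≤ n → j < l1 → Regular k j → E.Candidate k q (slot t j) →
                        CandidateShape k t j q
      Candidate-shape {t} {j} {q} t≤n j<l1 reg (q<y , _ , lt , pr) with prior-shape t≤n j<l1 q<y pr
      ... | in-G q<l0 pa with Ascends? j k
      ...   | yes asc = in-G q<l0 (inj₂ (Regular-Ascends⇒Ancestor reg asc))
      ...   | no ¬asc = in-G q<l0 (inj₁ (<-≤-trans q<l0 (m≤m+n l0 j) , s≤s (<⇒≤ (l0+j<last j<l1)) ,
                                        subst₂ _<_ (b≡a q k (<-trans q<l0 l0<last)) (entry-fixed t≤n j<l1 ¬asc) lt ,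
                                        pa))
      Candidate-shape {t} {j} {q} t≤n j<l1 reg (q<y , _ , lt , pr) | same-block i<l1 i<j refl pa =
        same-block i<l1 refl (+-monoʳ-< l0 i<j , s≤s (<⇒≤ (l0+j<last j<l1)) ,
                              shift-reflects-< t≤n i<l1 j<l1 (Ascends-intermediate reg i<j pa) lt , pa)
      Candidate-shape {t} {j} {q} t≤n j<l1 reg (q<y , _ , lt , pr) | earlier-block {s} {i} d k≤m0 s<t i<l1 refl pa
        with Ascends? j k
      ... | yes asc = earlier-block s<t i<l1 refl (A.Ancestor⇒Candidate (Regular-Ascends⇒Ancestor reg asc))
      ... | no ¬asc =
        earlier-block s<t i<l1 refl
          (m<m+n l0 (n≢0⇒n>0 j≢0) , s≤s (<⇒≤ (l0+j<last j<l1)) , l0-entry< , prior₀ d)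
        where
        l0-entry< : a l0 k < a (l0 + j) k
        l0-entry< = ≤-<-trans (a-l0≤b k≤m0 (≤-trans (<⇒≤ s<t) t≤n) i<l1 pa)
                              (subst (b (slot s i) k <_) (entry-fixed t≤n j<l1 ¬asc) lt)
        j≢0 : j ≢ 0
        j≢0 j≡0 = <-irrefl (sym (trans (cong (λ x → a (l0 + x) k) j≡0) (a-l0+0 k))) l0-entry<
        prior₀ : j ≡ 0 ⊎ A.Prior k l0 (l0 + j) → A.Prior k l0 (l0 + j)
        prior₀ (inj₁ j≡0) = ⊥-elim (j≢0 j≡0)
        prior₀ (inj₂ pr₀) = pr₀

      parent-image : ∀ {t j p′ p} → t ≤ n → j < l1 → Regular k j → A.Parent k p′ (l0 + j) →
                     Image t p′ p → E.Parent k p (slot t j)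
      parent-image {t} {j} {p′} {p} t≤n j<l1 reg P im =
        (p<y im , slot<len t≤n j<l1 , entry< im , prior-image t≤n j<l1 (A.Parent⇒Prior P) im) , after im
        where
        p<y : Image t p′ p → p < slot t j
        p<y (fixed p′<l0 refl)       = <-≤-trans p′<l0 (l0≤slot t j)
        p<y (shifted i<l1 refl refl) = slot-<ʳ (+-cancelˡ-< l0 _ _ (A.Parent⇒< P))
        entry< : Image t p′ p → b p k < b (slot t j) k
        entry< (fixed p′<l0 refl) =
          subst (_< b (slot t j) k) (sym (b≡a p′ k (<-trans p′<l0 l0<last)))
                (<-≤-trans (A.Parent⇒entry< P) (a≤b t≤n j<l1))
        entry< (shifted i<l1 refl refl) =
          shift-preserves-< t≤n i<l1 j<l1 (Ascends-parent P)
            (Ascends-intermediate reg (+-cancelˡ-< l0 _ _ (A.Parent⇒< P)) (A.Parent⇒Prior P)) (A.Parent⇒entry< P)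
        after : Image t p′ p → ∀ q → p < q → q < slot t j → ¬ E.Candidate k q (slot t j)
        after im q p<q _ c with Candidate-shape t≤n j<l1 reg c | im
        ... | in-G q<l0 (inj₁ ca) | fixed p′<l0 refl = proj₂ P q p<q (proj₁ ca) ca
        ... | in-G q<l0 (inj₂ an) | fixed p′<l0 refl = <⇒≱ p′<l0 (A.Ancestor≤Parent an P)
        ... | in-G q<l0 _         | shifted {i} _ refl refl = <⇒≱ (<-trans p<q q<l0) (l0≤slot t i)
        ... | same-block {i} _ refl ca | fixed p′<l0 refl =
          proj₂ P (l0 + i) (<-≤-trans p′<l0 (m≤m+n l0 i)) (proj₁ ca) ca
        ... | same-block {i} i<l1 refl ca | shifted i₁<l1 refl refl with slot-<⁻¹ i₁<l1 i<l1 p<q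
        ...   | inj₁ t<t          = <-irrefl refl t<t
        ...   | inj₂ (_ , i₁<i)   = proj₂ P (l0 + i) (+-monoʳ-< l0 i₁<i) (proj₁ ca) ca
        after im q p<q _ c | earlier-block _ _ refl ca | fixed p′<l0 refl = proj₂ P l0 p′<l0 (proj₁ ca) ca
        after im q p<q _ c | earlier-block s<t i<l1 refl _ | shifted _ refl refl = <-asym p<q (slot-<-block s<t i<l1)

      parent-preimage : ∀ {t j p} → t ≤ n → j < l1 → Regular k j → E.Parent k p (slot t j) →
                        ∃ λ p′ → A.Parent k p′ (l0 + j) × Image t p′ p
      parent-preimage {t} {j} t≤n j<l1 reg P with A.parent? k (l0 + j)
      ... | yes (p′ , P′) with image t p′ (<-trans (A.Parent⇒< P′) (l0+j<last j<l1))
      ...   | _ , im = p′ , P′ , subst (Image t p′) (E.Parent-unique (parent-image t≤n j<l1 reg P′ im) P) im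
      parent-preimage {t} {j} t≤n j<l1 reg P | no none =
        ⊥-elim (none (Product.map₂ proj₁ (A.Candidate⇒Parent
                       (proj₂ (CandidateShape⇒Candidate (Candidate-shape t≤n j<l1 reg (proj₁ P)))))))

      parent-first : ∀ {t i} → suc t ≤ n → k < m0 → i < l1 → A.Parent k (l0 + i) last →
                     E.Parent k (slot t i) (slot (suc t) 0)
      parent-first {t} {i} t<n k<m0 i<l1 P =
        (slot-<-block ≤-refl i<l1 , slot<len t<n 0<l1 , entry< , prior-first t<n k<m0 i<l1 (A.Parent⇒Prior P)) , after
        where
        entry< : b (slot t i) k < b (slot (suc t) 0) k
        entry< = subst₂ _<_ (sym (entry-ascending (<⇒≤ t<n) i<l1 (Ascends-toward-last k<m0 i<l1 (A.Parent⇒Prior P))))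
                            (sym (first-entry t<n k<m0)) (+-monoˡ-< (t * δ k) (A.Parent⇒entry< P))
        after : ∀ q → slot t i < q → q < slot (suc t) 0 → ¬ E.Candidate k q (slot (suc t) 0)
        after q p<q q<y c with prior-shape t<n 0<l1 q<y (proj₂ (proj₂ (proj₂ c)))
        ... | in-G q<l0 _ = <⇒≱ (<-trans p<q q<l0) (l0≤slot t i)
        ... | same-block _ () _ _
        ... | earlier-block {i = i′} _ _ s<1+t i′<l1 refl pr with slot-<⁻¹ i<l1 i′<l1 p<q
        ...   | inj₁ t<s = <⇒≱ t<s (≤-pred s<1+t)
        ...   | inj₂ (refl , i<i′) =
          proj₂ P (l0 + i′) (+-monoʳ-< l0 i<i′) (l0+j<last i′<l1)
            (l0+j<last i′<l1 , ≤-refl ,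
             +-cancelʳ-< (t * δ k) _ _
               (subst₂ _<_ (entry-ascending (<⇒≤ t<n) i′<l1 (Ascends-toward-last k<m0 i′<l1 pr))
                           (first-entry t<n k<m0) (proj₁ (proj₂ (proj₂ c)))) ,
             pr)

      parent-first⁻¹ : ∀ {t p} → suc t ≤ n → k < m0 → E.Parent k p (slot (suc t) 0) →
                       ∃ λ i → i < l1 × A.Parent k (l0 + i) last × p ≡ slot t i
      parent-first⁻¹ t<n k<m0 P with last-parent k<m0
      ... | i , i<l1 , Pi = i , i<l1 , Pi , E.Parent-unique P (parent-first t<n k<m0 i<l1 Pi)

      parentsAt : ParentsAt k
      parentsAt = record { parent-image = parent-image ; parent-preimage = parent-preimage
                         ; parent-first = parent-first ; parent-first⁻¹ = parent-first⁻¹ }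

    mutual
      priorsAt : ∀ k → PriorsAt k
      priorsAt zero    = priorsAt-zero
      priorsAt (suc r) = priorsAt-suc r (parentsAt r)

      parentsAt : ∀ k → ParentsAt k
      parentsAt k = FromPriors.parentsAt k (priorsAt k)

    module Consequences (k : ℕ) where
      open FromParents k (parentsAt k)
      open ParentsAt (parentsAt k)

      G-Ancestor⇒ : ∀ {t i j} → t ≤ n → i < l0 → j < l1 → E.Ancestor k i (slot t j) → A.Ancestor k i (l0 + j)
      G-Ancestor⇒ {t} t≤n i<l0 j<l1 e with Ancestor-shape t≤n j<l1 e
      ... | in-G _ a                                = a
      ... | same-block {i′} _ refl _                = ⊥-elim (<⇒≱ i<l0 (l0≤slot t i′))
      ... | earlier-block {s} {i′} _ _ _ _ refl _   = ⊥-elim (<⇒≱ i<l0 (l0≤slot s i′))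

      G-Ancestor : ∀ {t i j} → t ≤ n → i < l0 → j < l1 → E.Ancestor k i (slot t j) ⇔ A.Ancestor k i (l0 + j)
      G-Ancestor t≤n i<l0 j<l1 =
        mk⇔ (G-Ancestor⇒ t≤n i<l0 j<l1) (λ a → Ancestor-image t≤n j<l1 a (fixed i<l0 refl))

      block-Ancestor⇒ : ∀ {t i j} → t ≤ n → i < l1 → j < l1 → E.Ancestor k (slot t i) (slot t j) →
                        A.Ancestor k (l0 + i) (l0 + j)
      block-Ancestor⇒ {t} {i} t≤n i<l1 j<l1 e with Ancestor-shape t≤n j<l1 e
      ... | in-G q<l0 _ = ⊥-elim (<⇒≱ q<l0 (l0≤slot t i))
      ... | same-block i′<l1 eq a with slot-injective i<l1 i′<l1 eq
      ...   | _ , refl = a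
      block-Ancestor⇒ {t} {i} t≤n i<l1 j<l1 e | earlier-block _ _ s<t i′<l1 eq _ with slot-injective i<l1 i′<l1 eq
      ...   | refl , _ = ⊥-elim (<-irrefl refl s<t)

      block-Ancestor : ∀ {t i j} → t ≤ n → i < l1 → j < l1 →
                       E.Ancestor k (slot t i) (slot t j) ⇔ A.Ancestor k (l0 + i) (l0 + j)
      block-Ancestor t≤n i<l1 j<l1 =
        mk⇔ (block-Ancestor⇒ t≤n i<l1 j<l1) (λ a → Ancestor-image t≤n j<l1 a (shifted i<l1 refl refl))

      first-Ancestor⇒ : ∀ {t i} → suc t ≤ n → i < l1 → E.Ancestor k (slot t i) (slot (suc t) 0) →
                        A.Ancestor k (l0 + i) last
      first-Ancestor⇒ {t} {i} t<n i<l1 e with Ancestor-shape t<n 0<l1 e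
      ... | in-G q<l0 _ = ⊥-elim (<⇒≱ q<l0 (l0≤slot t i))
      ... | same-block i′<l1 eq _ with slot-injective i<l1 i′<l1 eq
      ...   | () , _
      first-Ancestor⇒ {t} {i} t<n i<l1 e | earlier-block _ _ _ i′<l1 eq a with slot-injective i<l1 i′<l1 eq
      ...   | refl , refl = a

      first-Ancestor : ∀ {t i} → suc t ≤ n → k < m0 → i < l1 →
                       E.Ancestor k (slot t i) (slot (suc t) 0) ⇔ A.Ancestor k (l0 + i) last
      first-Ancestor t<n k<m0 i<l1 = mk⇔ (first-Ancestor⇒ t<n i<l1) (Ancestor-first t<n k<m0 i<l1)

      Parent-G-or-block : ∀ {i p} → 0 < i → i < l1 → E.Parent k p (slot n i) → slot n 0 ≤ p ⊎ p < l0
      Parent-G-or-block 0<i i<l1 P with parent-preimage ≤-refl i<l1 (inj₁ 0<i) P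
      ... | _ , _ , fixed p′<l0 refl = inj₂ p′<l0
      ... | _ , _ , shifted _ _ refl = inj₁ (slot-≤ʳ z≤n)

      Ancestor-across : ∀ {s t i} → k < m0 → s < t → t ≤ n → i < l1 → A.Ancestor k (l0 + i) last →
                        E.Ancestor k (slot s i) (slot t 0)
      Ancestor-across {s} {suc t} k<m0 s<1+t t<n i<l1 a with m<1+n⇒m<n∨m≡n s<1+t
      ... | inj₂ refl = Ancestor-first t<n k<m0 i<l1 a
      ... | inj₁ s<t  = Ancestor-across k<m0 s<t (<⇒≤ t<n) i<l1 a ++⁺ Ancestor-first t<n k<m0 0<l1 l0+0→last
        where
        l0+0→last : A.Ancestor k (l0 + 0) last
        l0+0→last = subst (λ x → A.Ancestor k x last) (sym (+-identityʳ l0)) (l0-Ancestor-last (<⇒≤ k<m0))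

      blocks-Ancestor⇒ : ∀ {s t i j} → s < t → t ≤ n → i < l1 → j < l1 →
                         E.Ancestor k (slot s i) (slot t j) → Descends k j × k < m0 × A.Ancestor k (l0 + i) last
      blocks-Ancestor⇒ {s} {t} {i} s<t t≤n i<l1 j<l1 e with Ancestor-shape t≤n j<l1 e
      ... | in-G q<l0 _ = ⊥-elim (<⇒≱ q<l0 (l0≤slot s i))
      ... | same-block i′<l1 eq _ with slot-injective i<l1 i′<l1 eq
      ...   | refl , _ = ⊥-elim (<-irrefl refl s<t)
      blocks-Ancestor⇒ {s} {t} {i} s<t t≤n i<l1 j<l1 e | earlier-block d k<m0 _ i′<l1 eq a
        with slot-injective i<l1 i′<l1 eq
      ...   | refl , refl = d , k<m0 , a

      blocks-Ancestor⇐ : ∀ {s t i j} → s < t → t ≤ n → i < l1 → j < l1 →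
                         Descends k j × k < m0 × A.Ancestor k (l0 + i) last → E.Ancestor k (slot s i) (slot t j)
      blocks-Ancestor⇐ s<t t≤n i<l1 _ (inj₁ refl , k<m0 , a) = Ancestor-across k<m0 s<t t≤n i<l1 a
      blocks-Ancestor⇐ s<t t≤n i<l1 j<l1 (inj₂ d , k<m0 , a) =
        Ancestor-across k<m0 s<t t≤n i<l1 a ++⁺ Ancestor-image t≤n j<l1 d (shifted 0<l1 (sym (+-identityʳ l0)) refl)

      blocks-Ancestor : ∀ {s t i j} → s < t → t ≤ n → i < l1 → j < l1 →
                        E.Ancestor k (slot s i) (slot t j) ⇔ (Descends k j × k < m0 × A.Ancestor k (l0 + i) last)
      blocks-Ancestor s<t t≤n i<l1 j<l1 =
        mk⇔ (blocks-Ancestor⇒ s<t t≤n i<l1 j<l1) (blocks-Ancestor⇐ s<t t≤n i<l1 j<l1)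

length-take-≤ : ∀ {X : Set} k (xs : List X) → k ≤ length xs → length (take k xs) ≡ k
length-take-≤ k xs k≤xs = trans (length-take k xs) (m≤n⇒m⊓n≡m k≤xs)

module Layout (D : Column) (Ds : Array) (n : ℕ) (isA : IsArray (D ∷ Ds)) (m0 l0 : ℕ) (asc : ℕ → ℕ → Bool)
              (split : Par (D ∷ Ds) m0 l0 (length Ds)) (ascSpec : AscSpec (D ∷ Ds) (just m0) l0 asc) where

  A : Array
  A = D ∷ Ds

  last l1 : ℕ
  last = length Ds
  l1   = len1 A l0

  module DA = ArrayAncestry A

  m0-parent : Ancestry.Parent (ent A) (suc last) m0 l0 last
  m0-parent = DA.Par⇒Parent m0 split

  l0<last : l0 < last
  l0<last = Ancestry.Parent⇒< (ent A) (suc last) m0-parent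

  l0+l1≡last : l0 + l1 ≡ last
  l0+l1≡last = m+[n∸m]≡n (<⇒≤ l0<last)

  up : ℕ → ℕ → Bool
  up j m = below (just m0) m ∧ asc j m

  shift : ℕ → ℕ → ℕ
  shift i m = i * (ent A last m ∸ ent A l0 m)

  copies : ℕ → Array
  copies t = Bi A (just m0) l0 asc (suc t)

  U E : Array
  U = G A l0 ++ B0 A l0 ++ concat (applyUpTo copies n)
  E = expand A n (just m0) l0 asc

  length-G : length (G A l0) ≡ l0
  length-G = length-take-≤ l0 A (<⇒≤ (<-trans l0<last (n<1+n last)))

  length-B0 : length (B0 A l0) ≡ l1
  length-B0 = length-take-≤ l1 (drop l0 A) (subst (l1 ≤_) (sym (length-drop l0 A)) (∸-monoˡ-≤ l0 (n≤1+n last)))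

  length-copies : ∀ t → length (copies t) ≡ l1
  length-copies t = trans (length-blockFrom A (just m0) l0 asc (suc t) 0 (B0 A l0)) length-B0

  length-E : length E ≡ l0 + suc n * l1
  length-E = begin
    length E
      ≡⟨ length-trim (height U) U ⟩
    length U
      ≡⟨ length-++ (G A l0) ⟩
    length (G A l0) + length (B0 A l0 ++ concat (applyUpTo copies n))
      ≡⟨ cong (length (G A l0) +_) (length-++ (B0 A l0)) ⟩
    length (G A l0) + (length (B0 A l0) + length (concat (applyUpTo copies n)))
      ≡⟨ cong₂ _+_ length-G (cong₂ _+_ length-B0 (length-concat-applyUpTo copies l1 length-copies n)) ⟩
    l0 + suc n * l1
      ∎
    where open ≡-Reasoning

  0<l1 : 0 < l1
  0<l1 = m<n⇒0<n∸m l0<last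

  module X = Expansion (ent A) last l0 l1 m0 l0+l1≡last 0<l1 m0-parent

  col-G : ∀ {x} → x < l0 → col U x ≡ col A x
  col-G {x} x<l0 = trans (nth-++ˡ (G A l0) _ x (subst (x <_) (sym length-G) x<l0)) (nth-take l0 A x x<l0)

  col-after-G : ∀ y → col U (l0 + y) ≡ nth [] (B0 A l0 ++ concat (applyUpTo copies n)) y
  col-after-G y = trans (cong (λ z → col U (z + y)) (sym length-G)) (nth-++ʳ (G A l0) _ y)

  nth-B0 : ∀ {j} → j < l1 → nth [] (B0 A l0) j ≡ col A (l0 + j)
  nth-B0 {j} j<l1 = trans (nth-take l1 (drop l0 A) j j<l1) (nth-drop l0 A j)

  col-B0 : ∀ {j} → j < l1 → col U (l0 + j) ≡ col A (l0 + j)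
  col-B0 {j} j<l1 =
    trans (col-after-G j) (trans (nth-++ˡ (B0 A l0) _ j (subst (j <_) (sym length-B0) j<l1)) (nth-B0 j<l1))

  col-copy : ∀ {t j} → t < n → j < l1 →
             col U (l0 + (suc t * l1 + j)) ≡ bumpFrom (up j) (shift (suc t)) 0 (col A (l0 + j))
  col-copy {t} {j} t<n j<l1 = begin
    col U (l0 + (suc t * l1 + j))
      ≡⟨ cong (λ z → col U (l0 + z)) (+-assoc l1 (t * l1) j) ⟩
    col U (l0 + (l1 + (t * l1 + j)))
      ≡⟨ col-after-G _ ⟩
    nth [] (B0 A l0 ++ rest) (l1 + (t * l1 + j))
      ≡⟨ cong (λ z → nth [] (B0 A l0 ++ rest) (z + (t * l1 + j))) (sym length-B0) ⟩
    nth [] (B0 A l0 ++ rest) (length (B0 A l0) + (t * l1 + j))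
      ≡⟨ nth-++ʳ (B0 A l0) rest (t * l1 + j) ⟩
    nth [] rest (t * l1 + j)
      ≡⟨ nth-concat-applyUpTo copies l1 length-copies n t j t<n j<l1 ⟩
    nth [] (copies t) j
      ≡⟨ nth-blockFrom A (just m0) l0 asc (suc t) 0 (B0 A l0) j j<B0 ⟩
    bumpFrom (up j) (shift (suc t)) 0 (nth [] (B0 A l0) j)
      ≡⟨ cong (bumpFrom (up j) (shift (suc t)) 0) (nth-B0 j<l1) ⟩
    bumpFrom (up j) (shift (suc t)) 0 (col A (l0 + j))
      ∎
    where
    open ≡-Reasoning
    rest = concat (applyUpTo copies n)
    j<B0 = subst (j <_) (sym length-B0) j<l1

  ent-E : ∀ x m → ent E x m ≡ ent U x m
  ent-E = ent-trim (height U) U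

  ent-E-before-last : ∀ x m → x < last → ent E x m ≡ ent A x m
  ent-E-before-last x m x<last with x <? l0
  ... | yes x<l0 = trans (ent-E x m) (cong (λ c → nth 0 c m) (col-G x<l0))
  ... | no x≮l0 with X.inB0 (≮⇒≥ x≮l0) x<last
  ...   | j , j<l1 , refl = trans (ent-E (l0 + j) m) (cong (λ c → nth 0 c m) (col-B0 j<l1))

  -- C has the same height as every column of B0
  shift-beyond : ∀ i {j m} → j < l1 → length (col A (l0 + j)) ≤ m → shift i m ≡ 0
  shift-beyond i {j} {m} j<l1 h≤m = begin
    i * (ent A last m ∸ ent A l0 m) ≡⟨ cong (λ v → i * (v ∸ ent A l0 m)) (nth-beyond (col A last) m C-h≤m) ⟩
    i * (0 ∸ ent A l0 m)            ≡⟨ cong (i *_) (0∸n≡0 (ent A l0 m)) ⟩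
    i * 0                           ≡⟨ *-zeroʳ i ⟩
    0                               ∎
    where
    open ≡-Reasoning
    height≡ : ∀ {x} → x < suc last → length (col A x) ≡ proj₁ isA
    height≡ {x} = All⇒col A x (proj₂ isA)
    C-h≤m : length (col A last) ≤ m
    C-h≤m = subst (_≤ m) (trans (height≡ (<-trans (X.l0+j<last j<l1) (n<1+n last))) (sym (height≡ (n<1+n last))))
                  h≤m

  ent-E-copy : ∀ {t j m} → t < n → j < l1 →
               ent E (l0 + (suc t * l1 + j)) m ≡ ent A (l0 + j) m + (if up j m then shift (suc t) m else 0)
  ent-E-copy {t} {j} {m} t<n j<l1 =
    trans (ent-E _ m) (trans (cong (λ c → nth 0 c m) (col-copy t<n j<l1))
                             (nth-bumpFrom (up j) (shift (suc t)) 0 (col A (l0 + j)) m (shift-beyond (suc t) j<l1)))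

  Ascends⇒up : ∀ {j m} → j < l1 → X.Ascends j m → up j m ≡ true
  Ascends⇒up {j} {m} j<l1 (m<m0 , d) rewrite Equivalence.to T-≡ (<⇒<ᵇ m<m0) =
    Equivalence.from (ascSpec m0 refl j m j<l1 m<m0) (Sum.map₂ (DA.Ancestor⇒Anc m) d)

  up⇒Ascends : ∀ {j m} → j < l1 → up j m ≡ true → X.Ascends j m
  up⇒Ascends {j} {m} j<l1 up≡true with m <ᵇ m0 in m<ᵇm0
  ... | true = m<m0 , Sum.map₂ (DA.Anc⇒Ancestor m) (Equivalence.to (ascSpec m0 refl j m j<l1 m<m0) up≡true)
    where
    m<m0 : m < m0
    m<m0 = <ᵇ⇒< m m0 (Equivalence.from T-≡ m<ᵇm0)

  ¬Ascends⇒¬up : ∀ {j m} → j < l1 → ¬ X.Ascends j m → up j m ≡ false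
  ¬Ascends⇒¬up {j} {m} j<l1 ¬asc with up j m in up≡
  ... | false = refl
  ... | true  = ⊥-elim (¬asc (up⇒Ascends j<l1 up≡))

  ent-E-ascending : ∀ t j m → t ≤ n → j < l1 → X.Ascends j m →
                    ent E (l0 + (t * l1 + j)) m ≡ ent A (l0 + j) m + t * X.δ m
  ent-E-ascending zero    j m _   j<l1 _   = trans (ent-E-before-last _ m (X.l0+j<last j<l1)) (sym (+-identityʳ _))
  ent-E-ascending (suc t) j m t<n j<l1 asc rewrite ent-E-copy {t} {j} {m} t<n j<l1 | Ascends⇒up j<l1 asc = refl

  ent-E-fixed : ∀ t j m → t ≤ n → j < l1 → ¬ X.Ascends j m → ent E (l0 + (t * l1 + j)) m ≡ ent A (l0 + j) m
  ent-E-fixed zero    j m _   j<l1 _    = ent-E-before-last _ m (X.l0+j<last j<l1)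
  ent-E-fixed (suc t) j m t<n j<l1 ¬asc rewrite ent-E-copy {t} {j} {m} t<n j<l1 | ¬Ascends⇒¬up j<l1 ¬asc =
    +-identityʳ _

  module XE = X.Expanded (ent E) (length E) n length-E ent-E-before-last ent-E-ascending ent-E-fixed

  module DE = ArrayAncestry E

  Anc-E⇔ : ∀ {k p q p′ q′} → p ≡ p′ → q ≡ q′ → Anc E k p q ⇔ XE.E.Ancestor k p′ q′
  Anc-E⇔ refl refl = mk⇔ (DE.Anc⇒Ancestor _) (DE.Ancestor⇒Anc _)

  pos≡slot : ∀ t j → pos l0 l1 t j ≡ X.slot t j
  pos≡slot t j = trans (+-assoc l0 (t * l1) j) (sym (X.slot≡ t j))

  part-i : ∀ i j k → i < l0 → j < l1 → Anc E k i (pos l0 l1 0 j) ⇔ Anc E k i (pos l0 l1 n j)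
  part-i i j k i<l0 j<l1 = ⇔.trans (in-copy z≤n) (⇔.sym (in-copy ≤-refl))
    where
    open XE.Consequences k
    in-copy : ∀ {t} → t ≤ n → Anc E k i (pos l0 l1 t j) ⇔ X.A.Ancestor k i (l0 + j)
    in-copy {t} t≤n = ⇔.trans (Anc-E⇔ refl (pos≡slot t j)) (G-Ancestor t≤n i<l0 j<l1)

  part-ii : ∀ i j k → i < l1 → j < l1 →
            Anc E k (pos l0 l1 0 i) (pos l0 l1 0 j) ⇔ Anc E k (pos l0 l1 n i) (pos l0 l1 n j)
  part-ii i j k i<l1 j<l1 = ⇔.trans (in-copy z≤n) (⇔.sym (in-copy ≤-refl))
    where
    open XE.Consequences k
    in-copy : ∀ {t} → t ≤ n → Anc E k (pos l0 l1 t i) (pos l0 l1 t j) ⇔ X.A.Ancestor k (l0 + i) (l0 + j)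
    in-copy {t} t≤n = ⇔.trans (Anc-E⇔ (pos≡slot t i) (pos≡slot t j)) (block-Ancestor t≤n i<l1 j<l1)

  part-iii : 0 < n → ∀ m0′ → just m0 ≡ just m0′ → ∀ i k → i < l1 → k < m0′ →
             Anc A k (l0 + i) last ⇔ Anc E k (pos l0 l1 (n ∸ 1) i) (pos l0 l1 n 0)
  part-iii 0<n .m0 refl i k i<l1 k<m0 =
    ⇔.trans (mk⇔ (DA.Anc⇒Ancestor k) (DA.Ancestor⇒Anc k))
            (⇔.sym (⇔.trans (Anc-E⇔ (pos≡slot (n ∸ 1) i) last-copy)
                            (first-Ancestor (≤-reflexive 1+[n∸1]≡n) k<m0 i<l1)))
    where
    open XE.Consequences k
    1+[n∸1]≡n : suc (n ∸ 1) ≡ n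
    1+[n∸1]≡n = m+[n∸m]≡n 0<n
    last-copy : pos l0 l1 n 0 ≡ X.slot (suc (n ∸ 1)) 0
    last-copy = trans (cong (λ t → pos l0 l1 t 0) (sym 1+[n∸1]≡n)) (pos≡slot _ 0)

  part-iv : ∀ i k p → 0 < i → i < l1 → Par E k p (pos l0 l1 n i) → pos l0 l1 n 0 ≤ p ⊎ p < l0
  part-iv i k p 0<i i<l1 P
    with XE.Consequences.Parent-G-or-block k 0<i i<l1 (subst (XE.E.Parent k p) (pos≡slot n i) (DE.Par⇒Parent k P))
  ... | inj₁ slot≤p = inj₁ (subst (_≤ p) (sym (pos≡slot n 0)) slot≤p)
  ... | inj₂ p<l0   = inj₂ p<l0

  part-v : ∀ i j k n0 n1 → i < l1 → j < l1 → n0 < n1 → n1 < n →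
           Anc E k (pos l0 l1 n0 i) (pos l0 l1 n1 j) ⇔ Anc E k (pos l0 l1 n0 i) (pos l0 l1 (suc n1) j)
  part-v i j k n0 n1 i<l1 j<l1 n0<n1 n1<n =
    ⇔.trans (to-copy n0<n1 (<⇒≤ n1<n)) (⇔.sym (to-copy (m<n⇒m<1+n n0<n1) n1<n))
    where
    open XE.Consequences k
    to-copy : ∀ {t} → n0 < t → t ≤ n →
              Anc E k (pos l0 l1 n0 i) (pos l0 l1 t j) ⇔ (X.Descends k j × k < m0 × X.A.Ancestor k (l0 + i) last)
    to-copy {t} n0<t t≤n = ⇔.trans (Anc-E⇔ (pos≡slot n0 i) (pos≡slot t j)) (blocks-Ancestor n0<t t≤n i<l1 j<l1)

mainTheorem6 : (A : Array) (n : ℕ) → IsArray A → A ≢ [] →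
    (mm : Maybe ℕ) (l0 : ℕ) (asc : ℕ → ℕ → Bool) →
    M0 A mm → Split A mm l0 → AscSpec A mm l0 asc →
    let An = expand A n mm l0 asc
        l1 = len1 A l0
    in
    (∀ i j k → i < l0 → j < l1 →
       Anc An k i (pos l0 l1 0 j) ⇔ Anc An k i (pos l0 l1 n j))
    ×
    (∀ i j k → i < l1 → j < l1 →
       Anc An k (pos l0 l1 0 i) (pos l0 l1 0 j) ⇔ Anc An k (pos l0 l1 n i) (pos l0 l1 n j))
    ×
    (0 < n → ∀ m0 → mm ≡ just m0 → ∀ i k → i < l1 → k < m0 →
       Anc A k (l0 + i) (lastIdx A) ⇔ Anc An k (pos l0 l1 (n ∸ 1) i) (pos l0 l1 n 0))
    ×
    (∀ i k p → 0 < i → i < l1 → Par An k p (pos l0 l1 n i) →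
       (pos l0 l1 n 0 ≤ p) ⊎ (p < l0))
    ×
    (∀ i j k n0 n1 → i < l1 → j < l1 → n0 < n1 → n1 < n →
       Anc An k (pos l0 l1 n0 i) (pos l0 l1 n1 j) ⇔ Anc An k (pos l0 l1 n0 i) (pos l0 l1 (suc n1) j))
mainTheorem6 []       _ _ []≢[] = ⊥-elim ([]≢[] refl)
mainTheorem6 (D ∷ Ds) n _ _ nothing l0 asc _ refl _ =
  (λ _ _ _ _ j<l1 → ⊥-elim (B0-empty j<l1)) ,
  (λ _ _ _ i<l1 _ → ⊥-elim (B0-empty i<l1)) ,
  (λ _ _ ()) ,
  (λ _ _ _ _ i<l1 _ → ⊥-elim (B0-empty i<l1)) ,
  (λ _ _ _ _ _ i<l1 _ _ _ → ⊥-elim (B0-empty i<l1))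
  where
  B0-empty : ∀ {j} → j ≮ length Ds ∸ length Ds
  B0-empty {j} j<0 = n≮0 (subst (j <_) (n∸n≡0 (length Ds)) j<0)
mainTheorem6 (D ∷ Ds) n isA _ (just m0) l0 asc _ split ascSpec = part-i , part-ii , part-iii , part-iv , part-v
  where open Layout D Ds n isA m0 l0 asc split ascSpec
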